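{- Let $n,k$ be integers with $n\geq k\geq 4$ and let $T$ be a tree of order $n$. Then $$Sd_k(T)\leq \frac{k}{k-3}\,Sr_{k,3}(T)-\frac{6}{k-3}.$$ Moreover, equality holds if $T\cong P_3(a,b;x)$, where $x$ is a positive integer such that $\frac{n-3}{x}$ is an integer and $a,b$ are positive integers with $a+b=\frac{n-3}{x}\geq k$.
   Context: All graphs are finite, simple and connected. For a graph $G$ and $S\subseteq V(G)$, the Steiner distance $d_G(S)$ is the minimum number of edges of a connected subgraph of $G$ (equivalently, of a subtree of $G$) whose vertex set contains $S$. For integers $k\geq 2$, $1\leq k'\leq k$, $|V(G)|\geq k$, and a $k'$-subset $S'\subseteq V(G)$, the Steiner $(k,k')$-eccentricity of $S'$ is $\varepsilon_{k,k'}(S';G)=\max\{d_G(S): S'\subseteq S\subseteq V(G),\ |S|=k\}$. The Steiner $k$-eccentricity of a vertex $v$ is $\varepsilon_k(v;G)=\varepsilon_{k,1}(\{v\};G)$. The Steiner $k$-diameter is $Sd_k(G)=\max\{\varepsilon_k(v;G): v\in V(G)\}$, and the Steiner $(k,k')$-radius is $Sr_{k,k'}(G)=\min\{\varepsilon_{k,k'}(S';G): S'\subseteq V(G),\ |S'|=k'\}$. For positive integers $a,b,l,x$, the graph $P_l(a,b;x)$ is obtained from the path $P_l$ on $l$ vertices by attaching $a$ pendant paths of length $x$ at one end vertex of $P_l$ and $b$ pendant paths of length $x$ at the other end vertex (so $P_3(a,b;x)$ has order $3+(a+b)x$). -}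

module Defs where

open import Data.Nat using (ℕ; zero; suc; _+_; _*_; _≤_; _<_; _<ᵇ_)
open import Data.Nat.Properties using (1+n≢n)
open import Data.Bool using (Bool; true; false; _∧_; if_then_else_)
open import Data.Fin using (Fin; toℕ)
open import Data.Fin.Subset using (Subset; _∈_; _⊆_; ⁅_⁆; ∣_∣)
open import Data.List using (List; []; _∷_; _++_; [_]; length; map; allFin)
open import Data.Nat.ListAction using (sum)
open import Data.List.Relation.Unary.Linked using (Linked)
open import Data.List.Relation.Unary.Unique.Propositional using (Unique)
open import Data.Product using (Σ; Σ-syntax; _×_; _,_)
open import Data.Sum using (_⊎_; inj₁; inj₂)
open import Data.Empty using (⊥)
open import Relation.Nullary using (¬_)
open import Relation.Binary.PropositionalEquality using (_≡_; refl; sym; trans)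
open import Relation.Binary.Construct.Closure.ReflexiveTransitive using (Star)
open import Function.Bundles using (Bijection; _⤖_)

record Graph (n : ℕ) : Set₁ where
  field
    Adj     : Fin n → Fin n → Set
    sym-adj : ∀ u v → Adj u v → Adj v u
    irrefl  : ∀ v → ¬ Adj v v
open Graph public

Connected : ∀ {n} → Graph n → Set
Connected G = ∀ u v → Star (Adj G) u v

IsCycle : ∀ {n} → Graph n → Fin n → List (Fin n) → Set
IsCycle G v vs = 2 ≤ length vs × Unique (v ∷ vs) × Linked (Adj G) (v ∷ vs ++ [ v ])

Acyclic : ∀ {n} → Graph n → Set
Acyclic G = ∀ v vs → ¬ IsCycle G v vs

IsTree : ∀ {n} → Graph n → Set
IsTree G = Connected G × Acyclic G

_≅_ : ∀ {n m} → Graph n → Graph m → Set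
_≅_ {n} {m} G H = Σ (Fin n ⤖ Fin m) λ f →
  ∀ u v → (Adj G u v → Adj H (Bijection.to f u) (Bijection.to f v))
        × (Adj H (Bijection.to f u) (Bijection.to f v) → Adj G u v)

record Subgraph {n : ℕ} (G : Graph n) : Set where
  field
    V     : Subset n
    E     : Fin n → Fin n → Bool
    E-sym : ∀ u v → E u v ≡ E v u
    E-adj : ∀ u v → E u v ≡ true → Adj G u v
    E-V   : ∀ u v → E u v ≡ true → u ∈ V
open Subgraph public

ConnectedSub : ∀ {n} {G : Graph n} → Subgraph G → Set
ConnectedSub H = ∀ u v → u ∈ V H → v ∈ V H → Star (λ a b → E H a b ≡ true) u v

countEdges : ∀ {n} → (Fin n → Fin n → Bool) → ℕ
countEdges {n} E = sum (map (λ u → sum (map (λ v →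
  if (toℕ u <ᵇ toℕ v) ∧ E u v then 1 else 0) (allFin n))) (allFin n))

edges : ∀ {n} {G : Graph n} → Subgraph G → ℕ
edges H = countEdges (E H)

IsSteinerDist : ∀ {n} → Graph n → Subset n → ℕ → Set
IsSteinerDist G S d =
  (Σ[ H ∈ Subgraph G ] ConnectedSub H × S ⊆ V H × edges H ≡ d)
  × (∀ (H : Subgraph G) → ConnectedSub H → S ⊆ V H → d ≤ edges H)

IsSteinerEcc : ∀ {n} → Graph n → ℕ → Subset n → ℕ → Set
IsSteinerEcc G k S' e =
  (Σ[ S ∈ Subset _ ] S' ⊆ S × ∣ S ∣ ≡ k × IsSteinerDist G S e)
  × (∀ S d → S' ⊆ S → ∣ S ∣ ≡ k → IsSteinerDist G S d → d ≤ e)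

IsSteinerDiameter : ∀ {n} → Graph n → ℕ → ℕ → Set
IsSteinerDiameter G k D =
  (Σ[ v ∈ Fin _ ] IsSteinerEcc G k ⁅ v ⁆ D)
  × (∀ v e → IsSteinerEcc G k ⁅ v ⁆ e → e ≤ D)

IsSteinerRadius : ∀ {n} → Graph n → ℕ → ℕ → ℕ → Set
IsSteinerRadius G k k' R =
  (Σ[ S' ∈ Subset _ ] ∣ S' ∣ ≡ k' × IsSteinerEcc G k S' R)
  × (∀ S' e → ∣ S' ∣ ≡ k' → IsSteinerEcc G k S' e → R ≤ e)

-- P_3(a,b;x) on vertices 0..2+(a+b)x :
-- path 0 - 1 - 2 ; pendant path number p (p < a+b) has vertices
-- 3+p*x, …, 3+p*x+(x-1), its first vertex attached to 0 if p < a,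
-- to 2 if a ≤ p.

data PEdge (a b x : ℕ) : ℕ → ℕ → Set where
  e01   : PEdge a b x 0 1
  e12   : PEdge a b x 1 2
  left  : ∀ {p} → p < a → PEdge a b x 0 (3 + p * x)
  right : ∀ {p} → a ≤ p → p < a + b → PEdge a b x 2 (3 + p * x)
  along : ∀ {p j} → p < a + b → suc j < x →
          PEdge a b x (3 + p * x + j) (suc (3 + p * x + j))

PEdge-irrefl : ∀ {a b x u} → ¬ PEdge a b x u u
PEdge-irrefl {a} {b} {x} {u} e = go e refl
  where
  go : ∀ {u v} → PEdge a b x u v → u ≡ v → ⊥
  go e01 ()
  go e12 ()
  go (left _) ()
  go (right _ _) ()
  go (along {p} {j} _ _) eq = 1+n≢n (sym eq)

P3Adj : ∀ a b x → Fin (3 + (a + b) * x) → Fin (3 + (a + b) * x) → Set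
P3Adj a b x u v = PEdge a b x (toℕ u) (toℕ v) ⊎ PEdge a b x (toℕ v) (toℕ u)

P3 : (a b x : ℕ) → Graph (3 + (a + b) * x)
P3 a b x = record
  { Adj     = P3Adj a b x
  ; sym-adj = λ { u v (inj₁ e) → inj₂ e ; u v (inj₂ e) → inj₁ e }
  ; irrefl  = λ { v (inj₁ e) → PEdge-irrefl e ; v (inj₂ e) → PEdge-irrefl e }
  }

-- In a tree, the Steiner distance d(W) of a vertex set W is the number of edges that separate W,
-- i.e. that have vertices of W on both sides.
--
-- Let S be a k-set attaining Sd_k and S′ a 3-set attaining Sr_{k,3}. Shrink W = S ∪ S′
-- back to k vertices by deleting vertices outside S′ one at a time. An edge separating W but not S′
-- is lost by at most one of the |W ∖ S′| possible deletions, so the best deletion loses at most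
-- (d(W) − d(S′)) / |W ∖ S′|. Iterating, the final k-set W′ ⊇ S′ satisfies
-- (k − 3) d(W) + m d(S′) ≤ (k − 3 + m) d(W′) with m = |W ∖ S′| − (k − 3) ≤ 3; together with
-- d(S) ≤ d(W), 2 ≤ d(S′) ≤ d(W′) and d(W′) ≤ Sr_{k,3} this gives (k − 3) Sd_k + 6 ≤ k Sr_{k,3}.
--
-- The hub {0,1,2} has d = 2 and adding any vertex costs at most x more, so
-- by submodularity of d every k-set containing the hub has d ≤ 2 + (k − 3) x, and so Sr_{k,3} is at
-- most that. The leaves of k legs including legs at both ends of the hub are separated by all
-- 2 + k x edges of those legs and of the hub, so Sd_k ≥ 2 + k x; then k Sr ≤ (k − 3) Sd + 6.

module Submission where

open import Defs
open import Data.Bool using (Bool; true; false; _∧_; _∨_; if_then_else_; not)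
import Data.Bool.Properties as Boolₚ
open import Data.Empty using (⊥-elim)
open import Data.Fin using (Fin; zero; suc; toℕ; fromℕ<)
import Data.Fin.Properties as Finₚ
open import Data.Fin.Subset using (Subset; _∈_; _⊆_; ∣_∣; ⁅_⁆)
open import Data.Fin.Subset.Properties using (x∈⁅y⁆⇒x≡y)
open import Data.List using (List; []; _∷_; _++_; [_]; length; map; allFin; tabulate; applyUpTo; upTo; concatMap)
open import Data.List.Membership.Propositional using () renaming (_∈_ to _∈ₗ_)
open import Data.List.Membership.Propositional.Properties using (∈-map⁺; ∈-map⁻; ∈-++⁺ʳ)
open import Data.List.Properties using (length-applyUpTo; length-++; map-tabulate)
open import Data.List.Relation.Unary.All using (All; []; _∷_)
import Data.List.Relation.Unary.All as All
import Data.List.Relation.Unary.All.Properties as Allₚ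
open import Data.List.Relation.Unary.AllPairs using (AllPairs; []; _∷_)
import Data.List.Relation.Unary.AllPairs as AllPairs
import Data.List.Relation.Unary.AllPairs.Properties as AllPairsₚ
open import Data.List.Relation.Unary.Any using (Any; here; there)
import Data.List.Relation.Unary.Any as Any
open import Data.List.Relation.Unary.Linked using (Linked; [-]; _∷_)
open import Data.List.Relation.Unary.Unique.Propositional using (Unique)
import Data.Nat.ListAction as ListAction
open import Data.Nat using (ℕ; zero; suc; _+_; _*_; _∸_; _≤_; _<_; z≤n; s≤s; _<ᵇ_; _≤?_; _<?_)
open import Data.Nat.DivMod using (_/_; _%_; m≡m%n+[m/n]*n; m%n<n; m/n*n≤m)
open import Data.Nat.Properties
open import Algebra.Properties.Semiring.Sum +-*-semiring
  using (sum; sum-cong-≗; ∑-distrib-+; ∑-comm; *-distribˡ-sum; sum-replicate-zero)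
open import Data.Nat.Solver using (module +-*-Solver)
open import Data.Product using (Σ-syntax; _×_; _,_; proj₁; proj₂)
open import Data.Sum using (_⊎_; inj₁; inj₂)
open import Data.Vec using (Vec; lookup) renaming (tabulate to vtabulate)
open import Data.Vec.Properties using ([]=⇒lookup; lookup⇒[]=; lookup∘tabulate)
open import Function using (_∘_; id)
open import Function.Bundles using (Bijection; mk⇔)
open import Relation.Binary.Construct.Closure.ReflexiveTransitive
  using (Star; ε; _◅_; _◅◅_; revApp; reverse) renaming (map to Star-map)
open import Relation.Binary.Definitions using (tri<; tri≈; tri>)
open import Relation.Binary.PropositionalEquality hiding ([_])
open import Relation.Nullary using (¬_; Dec; yes; no; does; contradiction)
open import Relation.Nullary.Decidable using (_×-dec_; _⊎-dec_; dec-true; dec-false; does-⇔; decidable-stable)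
open import Relation.Nullary.Decidable.Core using (¬¬-excluded-middle)

sum-mono-≤ : ∀ {n} {f g : Fin n → ℕ} → (∀ i → f i ≤ g i) → sum f ≤ sum g
sum-mono-≤ {zero}  f≤g = z≤n
sum-mono-≤ {suc n} f≤g = +-mono-≤ (f≤g zero) (sum-mono-≤ (f≤g ∘ suc))

sum-zero : ∀ {n} (f : Fin n → ℕ) → (∀ i → f i ≡ 0) → sum f ≡ 0
sum-zero {n} f f≡0 = trans (sum-cong-≗ f≡0) (sum-replicate-zero n)

sum-single : ∀ {n} (f : Fin n → ℕ) (k : Fin n) → (∀ i → i ≢ k → f i ≡ 0) → sum f ≡ f k
sum-single f zero    f≡0 = trans (cong (f zero +_) (sum-zero (f ∘ suc) (λ i → f≡0 (suc i) λ ()))) (+-identityʳ _)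
sum-single f (suc k) f≡0 rewrite f≡0 zero (λ ()) =
  sum-single (f ∘ suc) k (λ i i≢k → f≡0 (suc i) (i≢k ∘ Finₚ.suc-injective))

sum-≤-* : ∀ {n} (f : Fin n → ℕ) c → (∀ i → f i ≤ c) → sum f ≤ n * c
sum-≤-* {zero}  f c f≤c = z≤n
sum-≤-* {suc n} f c f≤c = +-mono-≤ (f≤c zero) (sum-≤-* (f ∘ suc) c (f≤c ∘ suc))

sum-map-allFin : ∀ {n} (g : Fin n → ℕ) → ListAction.sum (map g (allFin n)) ≡ sum g
sum-map-allFin g = trans (cong ListAction.sum (map-tabulate id g)) (sum-tabulate g)
  where
  sum-tabulate : ∀ {n} (g : Fin n → ℕ) → ListAction.sum (tabulate g) ≡ sum g
  sum-tabulate {zero}  g = refl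
  sum-tabulate {suc n} g = cong (g zero +_) (sum-tabulate (g ∘ suc))

indicator : Bool → ℕ
indicator b = if b then 1 else 0

indicator-mono : ∀ {a b : Bool} → (a ≡ true → b ≡ true) → indicator a ≤ indicator b
indicator-mono {false} a⇒b = z≤n
indicator-mono {true}  a⇒b rewrite a⇒b refl = ≤-refl

indicator≤1 : ∀ b → indicator b ≤ 1
indicator≤1 true  = ≤-refl
indicator≤1 false = z≤n

count : ∀ {n} → (Fin n → Bool) → ℕ
count X = sum (indicator ∘ X)

weightedSum : ∀ {n} → (Fin n → Bool) → (Fin n → ℕ) → ℕ
weightedSum X g = sum (λ i → indicator (X i) * g i)

weightedSum-≤ : ∀ {n} (X : Fin n → Bool) (g : Fin n → ℕ) M →
  (∀ i → X i ≡ true → g i ≤ M) → weightedSum X g ≤ count X * M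
weightedSum-≤ {zero}  X g M g≤M = z≤n
weightedSum-≤ {suc n} X g M g≤M with X zero in X0
... | true  = +-mono-≤ (≤-trans (≤-reflexive (+-identityʳ _)) (g≤M zero X0))
                       (weightedSum-≤ (X ∘ suc) (g ∘ suc) M (g≤M ∘ suc))
... | false = weightedSum-≤ (X ∘ suc) (g ∘ suc) M (g≤M ∘ suc)

∈⇒count≥1 : ∀ {n} (X : Fin n → Bool) i → X i ≡ true → 1 ≤ count X
∈⇒count≥1 X zero    Xi rewrite Xi = s≤s z≤n
∈⇒count≥1 X (suc i) Xi = ≤-trans (∈⇒count≥1 (X ∘ suc) i Xi) (m≤n+m _ _)

argmax : ∀ {n} (X : Fin n → Bool) (g : Fin n → ℕ) →
  count X ≡ 0 ⊎ (Σ[ s ∈ Fin n ] X s ≡ true × (∀ i → X i ≡ true → g i ≤ g s))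
argmax {zero}  X g = inj₁ refl
argmax {suc n} X g with X zero in X0 | argmax (X ∘ suc) (g ∘ suc)
... | false | inj₁ none = inj₁ none
... | false | inj₂ (s , Xs , max) =
  inj₂ (suc s , Xs , λ { zero X0′ → contradiction (trans (sym X0) X0′) λ () ; (suc i) → max i })
... | true  | inj₁ none =
  inj₂ (zero , X0 , λ { zero _ → ≤-refl
                      ; (suc i) Xi → contradiction (subst (1 ≤_) none (∈⇒count≥1 (X ∘ suc) i Xi)) λ () })
... | true  | inj₂ (s , Xs , max) with g zero ≤? g (suc s)
...   | yes g0≤ = inj₂ (suc s , Xs , λ { zero _ → g0≤ ; (suc i) → max i })
...   | no  g0≰ = inj₂ (zero , X0 , λ { zero _ → ≤-refl ; (suc i) Xi → ≤-trans (max i Xi) (≰⇒≥ g0≰) })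

weightedSum≤count*max : ∀ {n} (X : Fin n → Bool) (g : Fin n → ℕ) → 1 ≤ count X →
  Σ[ s ∈ Fin n ] X s ≡ true × weightedSum X g ≤ count X * g s
weightedSum≤count*max X g X≢∅ with argmax X g
... | inj₁ none = contradiction (subst (1 ≤_) none X≢∅) λ ()
... | inj₂ (s , Xs , max) = s , Xs , weightedSum-≤ X g (g s) max

weightedSum-∑∑ : ∀ {n m} (X : Fin n → Bool) (f : Fin n → Fin m → Fin m → ℕ) →
  weightedSum X (λ s → sum (λ u → sum (λ v → f s u v))) ≡ sum (λ u → sum (λ v → weightedSum X (λ s → f s u v)))
weightedSum-∑∑ X f = begin
  sum (λ s → indicator (X s) * sum (λ u → sum (λ v → f s u v)))
    ≡⟨ sum-cong-≗ (λ s → trans (*-distribˡ-sum (indicator (X s)) (λ u → sum (f s u)))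
                               (sum-cong-≗ (λ u → *-distribˡ-sum (indicator (X s)) (f s u)))) ⟩
  sum (λ s → sum (λ u → sum (λ v → indicator (X s) * f s u v)))
    ≡⟨ ∑-comm (λ s u → sum (λ v → indicator (X s) * f s u v)) ⟩
  sum (λ u → sum (λ s → sum (λ v → indicator (X s) * f s u v)))
    ≡⟨ sum-cong-≗ (λ u → ∑-comm (λ s v → indicator (X s) * f s u v)) ⟩
  sum (λ u → sum (λ v → weightedSum X (λ s → f s u v))) ∎
  where open ≡-Reasoning

does⇒ : ∀ {P : Set} (p? : Dec P) → does p? ≡ true → P
does⇒ (yes p) _ = p

-- Abstract, so that `with` can abstract over `a == b` in goals instead of seeing it reduce.
abstract
  _≟ᶠ_ : ∀ {n} (a b : Fin n) → Dec (a ≡ b)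
  _≟ᶠ_ = Finₚ._≟_

_==_ : ∀ {n} → Fin n → Fin n → Bool
a == b = does (a ≟ᶠ b)

==-refl : ∀ {n} (a : Fin n) → (a == a) ≡ true
==-refl a = dec-true (a ≟ᶠ a) refl

==⇒≡ : ∀ {n} {a b : Fin n} → (a == b) ≡ true → a ≡ b
==⇒≡ {a = a} {b} = does⇒ (a ≟ᶠ b)

≢⇒==false : ∀ {n} {a b : Fin n} → a ≢ b → (a == b) ≡ false
≢⇒==false {a = a} {b} = dec-false (a ≟ᶠ b)

_⊆ᵇ_ : ∀ {n} → (Fin n → Bool) → (Fin n → Bool) → Set
X ⊆ᵇ Y = ∀ x → X x ≡ true → Y x ≡ true

_∖_ : ∀ {n} → (Fin n → Bool) → (Fin n → Bool) → Fin n → Bool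
(X ∖ Y) z = X z ∧ not (Y z)

remove : ∀ {n} → Fin n → (Fin n → Bool) → Fin n → Bool
remove s X z = X z ∧ not (z == s)

insert : ∀ {n} → Fin n → (Fin n → Bool) → Fin n → Bool
insert y X z = (z == y) ∨ X z

image : ∀ {n} → (ℕ → Fin n) → List ℕ → Fin n → Bool
image h []       z = false
image h (q ∷ qs) = insert (h q) (image h qs)

∖⇒∈ˡ : ∀ {n} {X Y : Fin n → Bool} {z} → (X ∖ Y) z ≡ true → X z ≡ true
∖⇒∈ˡ {X = X} {z = z} e with X z
... | true = refl

∖⇒∉ʳ : ∀ {n} {X Y : Fin n → Bool} {z} → (X ∖ Y) z ≡ true → Y z ≡ false
∖⇒∉ʳ {X = X} {Y} {z} e with X z | Y z
... | true | false = refl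

∈-remove : ∀ {n} {X : Fin n → Bool} {s z} → X z ≡ true → z ≢ s → remove s X z ≡ true
∈-remove {s = s} {z} Xz z≢s rewrite Xz | ≢⇒==false z≢s = refl

remove⇒ : ∀ {n} {X : Fin n → Bool} {s z} → remove s X z ≡ true → X z ≡ true × z ≢ s
remove⇒ {X = X} {s} {z} e with X z | z ≟ᶠ s
... | true | no z≢s = refl , z≢s

∈-insert-new : ∀ {n} {X : Fin n → Bool} {y} → insert y X y ≡ true
∈-insert-new {y = y} rewrite ==-refl y = refl

∈-insert-old : ∀ {n} {X : Fin n → Bool} {y z} → X z ≡ true → insert y X z ≡ true
∈-insert-old {y = y} {z} Xz rewrite Xz = Boolₚ.∨-zeroʳ (z == y)

insert⇒ : ∀ {n} {X : Fin n → Bool} {y z} → insert y X z ≡ true → z ≡ y ⊎ X z ≡ true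
insert⇒ {X = X} {y} {z} e with z == y in z==y | X z
... | true  | _    = inj₁ (==⇒≡ z==y)
... | false | true = inj₂ refl

∖-remove : ∀ {n} (X Y : Fin n → Bool) s z → (remove s X ∖ Y) z ≡ remove s (X ∖ Y) z
∖-remove X Y s z with X z | Y z | z == s
... | true  | true  | true  = refl
... | true  | true  | false = refl
... | true  | false | true  = refl
... | true  | false | false = refl
... | false | _     | _     = refl

∈-image : ∀ {n} (h : ℕ → Fin n) {q qs} → q ∈ₗ qs → image h qs (h q) ≡ true
∈-image h {q} {_ ∷ qs} (here refl) = ∈-insert-new {X = image h qs}
∈-image h {q} {q′ ∷ qs} (there q∈qs) = ∈-insert-old {X = image h qs} {y = h q′} (∈-image h q∈qs)

image⇒ : ∀ {n} (h : ℕ → Fin n) qs {z} → image h qs z ≡ true → Σ[ q ∈ ℕ ] q ∈ₗ qs × z ≡ h q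
image⇒ h (q ∷ qs) e with insert⇒ {X = image h qs} e
... | inj₁ z≡hq = q , here refl , z≡hq
... | inj₂ e′ = let (q′ , q′∈ , z≡) = image⇒ h qs e′ in q′ , there q′∈ , z≡

count-cong : ∀ {n} {X Y : Fin n → Bool} → (∀ x → X x ≡ Y x) → count X ≡ count Y
count-cong X≗Y = sum-cong-≗ (cong indicator ∘ X≗Y)

count-mono : ∀ {n} {X Y : Fin n → Bool} → X ⊆ᵇ Y → count X ≤ count Y
count-mono X⊆Y = sum-mono-≤ (indicator-mono ∘ X⊆Y)

count-singleton : ∀ {n} (s : Fin n) → count (_== s) ≡ 1
count-singleton s = trans (sum-single _ s (λ i i≢s → cong indicator (≢⇒==false i≢s)))
                          (cong indicator (==-refl s))

count-remove : ∀ {n} (X : Fin n → Bool) s → X s ≡ true → count X ≡ suc (count (remove s X))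
count-remove X s Xs = begin
  count X                                                     ≡⟨ sum-cong-≗ split ⟩
  sum (λ z → indicator (remove s X z) + indicator (z == s))   ≡⟨ ∑-distrib-+ (indicator ∘ remove s X) _ ⟩
  count (remove s X) + count (_== s)                          ≡⟨ cong (count (remove s X) +_) (count-singleton s) ⟩
  count (remove s X) + 1                                      ≡⟨ +-comm _ 1 ⟩
  suc (count (remove s X))                                    ∎
  where
  open ≡-Reasoning
  split : ∀ z → indicator (X z) ≡ indicator (remove s X z) + indicator (z == s)
  split z with z ≟ᶠ s
  ... | yes refl rewrite Xs = refl
  ... | no _ with X z
  ...   | true  = refl
  ...   | false = refl

count-insert : ∀ {n} (X : Fin n → Bool) s → X s ≡ false → count (insert s X) ≡ suc (count X)
count-insert X s Xs = trans (sum-cong-≗ split)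
  (trans (∑-distrib-+ (λ z → indicator (z == s)) (indicator ∘ X)) (cong (_+ count X) (count-singleton s)))
  where
  split : ∀ z → indicator (insert s X z) ≡ indicator (z == s) + indicator (X z)
  split z with z ≟ᶠ s
  ... | yes refl rewrite Xs = refl
  ... | no _ = refl

count-∖ : ∀ {n} (X Y : Fin n → Bool) → Y ⊆ᵇ X → count X ≡ count (X ∖ Y) + count Y
count-∖ X Y Y⊆X = trans (sum-cong-≗ split) (∑-distrib-+ (indicator ∘ (X ∖ Y)) (indicator ∘ Y))
  where
  split : ∀ z → indicator (X z) ≡ indicator ((X ∖ Y) z) + indicator (Y z)
  split z with Y z in Yz
  ... | true rewrite Y⊆X z Yz = refl
  ... | false with X z
  ...   | true  = refl
  ...   | false = refl

count-≤-∖ : ∀ {n} (X Y : Fin n → Bool) → count X ≤ count (X ∖ Y) + count Y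
count-≤-∖ X Y = subst (count X ≤_) (∑-distrib-+ (indicator ∘ (X ∖ Y)) (indicator ∘ Y)) (sum-mono-≤ split)
  where
  split : ∀ z → indicator (X z) ≤ indicator ((X ∖ Y) z) + indicator (Y z)
  split z with X z | Y z
  ... | true  | true  = s≤s z≤n
  ... | true  | false = s≤s z≤n
  ... | false | _     = z≤n

count≥1⇒∃ : ∀ {n} (X : Fin n → Bool) → 1 ≤ count X → Σ[ z ∈ Fin n ] X z ≡ true
count≥1⇒∃ {suc n} X X≢∅ with X zero in X0
... | true  = zero , X0
... | false = let (z , Xz) = count≥1⇒∃ (X ∘ suc) X≢∅ in suc z , Xz

count≤1 : ∀ {n} (X : Fin n → Bool) → (∀ s t → X s ≡ true → X t ≡ true → s ≡ t) → count X ≤ 1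
count≤1 {zero}  X unique = z≤n
count≤1 {suc n} X unique with X zero in X0
... | true  = ≤-reflexive (cong suc (sum-zero (indicator ∘ X ∘ suc) rest))
  where
  rest : ∀ i → indicator (X (suc i)) ≡ 0
  rest i with X (suc i) in Xi
  ... | true  = contradiction (unique zero (suc i) X0 Xi) λ ()
  ... | false = refl
... | false = count≤1 (X ∘ suc) (λ s t Xs Xt → Finₚ.suc-injective (unique (suc s) (suc t) Xs Xt))

count-all : ∀ {n} → count {n} (λ _ → true) ≡ n
count-all {zero}  = refl
count-all {suc n} = cong suc (count-all {n})

count-image : ∀ {n} (h : ℕ → Fin n) qs → AllPairs (λ q q′ → h q ≢ h q′) qs → count (image h qs) ≡ length qs
count-image {n} h []       _ = sum-replicate-zero n
count-image h (q ∷ qs) (q∉ ∷ distinct) =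
  trans (count-insert (image h qs) (h q) fresh) (cong suc (count-image h qs distinct))
  where
  fresh : image h qs (h q) ≡ false
  fresh with image h qs (h q) in e
  ... | false = refl
  ... | true  = let (q′ , q′∈ , hq≡) = image⇒ h qs e in contradiction hq≡ (All.lookup q∉ q′∈)

∈-tabulate⁻ : ∀ {n} (X : Fin n → Bool) {x} → x ∈ vtabulate X → X x ≡ true
∈-tabulate⁻ X {x} x∈ = trans (sym (lookup∘tabulate X x)) ([]=⇒lookup x∈)

∈-tabulate⁺ : ∀ {n} (X : Fin n → Bool) {x} → X x ≡ true → x ∈ vtabulate X
∈-tabulate⁺ X {x} Xx = lookup⇒[]= x (vtabulate X) (trans (lookup∘tabulate X x) Xx)

∣∣≡count : ∀ {n} (S : Subset n) → ∣ S ∣ ≡ count (lookup S)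
∣∣≡count Vec.[] = refl
∣∣≡count (true Vec.∷ S) = cong suc (∣∣≡count S)
∣∣≡count (false Vec.∷ S) = ∣∣≡count S

∣tabulate∣≡count : ∀ {n} (X : Fin n → Bool) → ∣ vtabulate X ∣ ≡ count X
∣tabulate∣≡count X = trans (∣∣≡count (vtabulate X)) (count-cong (lookup∘tabulate X))

weightedSum-split : ∀ {n} (X b : Fin n → Bool) →
  count X ≡ weightedSum X (indicator ∘ b) + count (X ∖ b)
weightedSum-split X b =
  trans (sum-cong-≗ split) (∑-distrib-+ (λ s → indicator (X s) * indicator (b s)) (indicator ∘ (X ∖ b)))
  where
  split : ∀ s → indicator (X s) ≡ indicator (X s) * indicator (b s) + indicator ((X ∖ b) s)
  split s with X s | b s
  ... | true  | true  = refl
  ... | true  | false = refl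
  ... | false | _     = refl

weightedSum-1 : ∀ {n} (X : Fin n → Bool) (g : Fin n → ℕ) → (∀ s → X s ≡ true → g s ≡ 1) →
  weightedSum X g ≡ count X
weightedSum-1 X g g≡1 = sum-cong-≗ pointwise
  where
  pointwise : ∀ s → indicator (X s) * g s ≡ indicator (X s)
  pointwise s with X s in Xs
  ... | true rewrite g≡1 s Xs = refl
  ... | false = refl

count≡suc⇒∃ : ∀ {n m} (X : Fin n → Bool) → count X ≡ suc m →
  Σ[ a ∈ Fin n ] X a ≡ true × count (remove a X) ≡ m
count≡suc⇒∃ X X≡1+m with count≥1⇒∃ X (subst (1 ≤_) (sym X≡1+m) (s≤s z≤n))
... | a , Xa = a , Xa , suc-injective (trans (sym (count-remove X a Xa)) X≡1+m)

count≡3⇒three : ∀ {n} (X : Fin n → Bool) → count X ≡ 3 →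
  Σ[ a ∈ Fin n ] Σ[ b ∈ Fin n ] Σ[ c ∈ Fin n ]
    X a ≡ true × X b ≡ true × X c ≡ true × a ≢ b × a ≢ c × b ≢ c
count≡3⇒three X X≡3 with count≡suc⇒∃ X X≡3
... | a , Xa , X-a≡2 with count≡suc⇒∃ (remove a X) X-a≡2
...   | b , X-a∋b , X-a-b≡1 with count≡suc⇒∃ (remove b (remove a X)) X-a-b≡1
...     | c , X-a-b∋c , _ with remove⇒ {X = X} X-a∋b | remove⇒ {X = remove a X} X-a-b∋c
...       | Xb , b≢a | X-a∋c , c≢b with remove⇒ {X = X} X-a∋c
...         | Xc , c≢a = a , b , c , Xa , Xb , Xc , b≢a ∘ sym , c≢a ∘ sym , c≢b ∘ sym

⊆-extend : ∀ {n} (X : Fin n → Bool) d k → count X + d ≡ k → k ≤ n →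
  Σ[ Z ∈ (Fin n → Bool) ] X ⊆ᵇ Z × count Z ≡ k
⊆-extend X zero    k X+0≡k k≤n = X , (λ _ Xx → Xx) , trans (sym (+-identityʳ _)) X+0≡k
⊆-extend {n} X (suc d) k X+d≡k k≤n with count≥1⇒∃ ((λ _ → true) ∖ X) complement≢∅
  where
  complement≢∅ : 1 ≤ count ((λ _ → true) ∖ X)
  complement≢∅ = +-cancelʳ-≤ (count X) 1 _ (begin
    suc (count X)                            ≤⟨ s≤s (m≤m+n (count X) d) ⟩
    suc (count X + d)                        ≡⟨ +-suc (count X) d ⟨
    count X + suc d                          ≡⟨ X+d≡k ⟩
    k                                        ≤⟨ k≤n ⟩
    n                                        ≡⟨ count-all ⟨
    count {n} (λ _ → true)                   ≡⟨ count-∖ (λ _ → true) X (λ _ _ → refl) ⟩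
    count ((λ _ → true) ∖ X) + count X       ∎)
    where open ≤-Reasoning
... | z , z∉X with ⊆-extend (insert z X) d k
                  (trans (cong (_+ d) (count-insert X z (∖⇒∉ʳ {X = λ _ → true} {X} z∉X)))
                         (trans (sym (+-suc (count X) d)) X+d≡k)) k≤n
...   | Z , X+z⊆Z , Z≡k = Z , (λ x Xx → X+z⊆Z x (∈-insert-old {X = X} {y = z} Xx)) , Z≡k

private variable
  A : Set
  R R′ : A → A → Set
  x₁ x₂ x₃ : A

inner : Star R x₁ x₂ → List _
inner ε = []
inner (_◅_ {j = c} _ p) = c ∷ inner p

verts : Star R x₁ x₂ → List _
verts {x₁ = x} p = x ∷ inner p

len : Star R x₁ x₂ → ℕ
len ε       = 0
len (_ ◅ p) = suc (len p)

steps : Star R x₁ x₂ → List (_ × _)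
steps ε = []
steps (_◅_ {i = s} {j = c} _ p) = (s , c) ∷ steps p

length-steps : (p : Star R x₁ x₂) → length (steps p) ≡ len p
length-steps ε       = refl
length-steps (_ ◅ p) = cong suc (length-steps p)

len-◅◅ : (p : Star R x₁ x₂) (q : Star R x₂ x₃) → len (p ◅◅ q) ≡ len p + len q
len-◅◅ ε       q = refl
len-◅◅ (_ ◅ p) q = cong suc (len-◅◅ p q)

inner-map : (f : ∀ {a b} → R a b → R′ a b) (p : Star R x₁ x₂) → inner (Star-map f p) ≡ inner p
inner-map f ε       = refl
inner-map f (_ ◅ p) = cong (_ ∷_) (inner-map f p)

last∈verts : (p : Star R x₁ x₂) → x₂ ∈ₗ verts p
last∈verts ε       = here refl
last∈verts (_ ◅ p) = there (last∈verts p)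

∈-verts-◅◅ˡ : (p : Star R x₁ x₂) (q : Star R x₂ x₃) → ∀ {w} → w ∈ₗ verts p → w ∈ₗ verts (p ◅◅ q)
∈-verts-◅◅ˡ ε       q (here refl) = here refl
∈-verts-◅◅ˡ (_ ◅ p) q (here w≡)   = here w≡
∈-verts-◅◅ˡ (_ ◅ p) q (there w∈p) = there (∈-verts-◅◅ˡ p q w∈p)

All-verts-◅◅ : ∀ {P : A → Set} (p : Star R x₁ x₂) (q : Star R x₂ x₃) →
  All P (verts p) → All P (verts q) → All P (verts (p ◅◅ q))
All-verts-◅◅ ε       q _          Pq = Pq
All-verts-◅◅ (_ ◅ p) q (Px ∷ Pp) Pq = Px ∷ All-verts-◅◅ p q Pp Pq

All-verts-reverse : ∀ {P : A → Set} (sym : ∀ {a b} → R a b → R b a) (p : Star R x₁ x₂) →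
  All P (verts p) → All P (verts (reverse sym p))
All-verts-reverse {P = P} sym p Pp = go p ε Pp (All.head Pp ∷ [])
  where
  go : ∀ {a b c} (p : Star _ a b) (q : Star _ a c) →
       All P (verts p) → All P (verts q) → All P (verts (revApp sym p q))
  go ε       q _        Pq = Pq
  go (_ ◅ p) q (_ ∷ Pp) Pq = go p _ Pp (All.head Pp ∷ Pq)

prefixTo : (p : Star R x₁ x₂) → x₃ ∈ₗ verts p → Star R x₁ x₃
prefixTo ε       (here refl)  = ε
prefixTo (_ ◅ p) (here refl)  = ε
prefixTo (r ◅ p) (there z∈p) = r ◅ prefixTo p z∈p

steps-prefixTo : (p : Star R x₁ x₂) (z∈p : x₃ ∈ₗ verts p) →
  ∀ {e} → e ∈ₗ steps (prefixTo p z∈p) → e ∈ₗ steps p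
steps-prefixTo ε       (here refl) ()
steps-prefixTo (_ ◅ p) (here refl) ()
steps-prefixTo (_ ◅ p) (there z∈p) (here e≡)  = here e≡
steps-prefixTo (_ ◅ p) (there z∈p) (there e∈) = there (steps-prefixTo p z∈p e∈)

suffixFrom : (p : Star R x₁ x₂) → x₃ ∈ₗ verts p → Σ[ q ∈ Star R x₃ x₂ ] (Unique (verts p) → Unique (verts q))
suffixFrom ε       (here refl)  = ε , id
suffixFrom (r ◅ p) (here refl)  = (r ◅ p) , id
suffixFrom (_ ◅ p) (there z∈p) with suffixFrom p z∈p
... | q , unique = q , λ { (_ ∷ u) → unique u }

linked-snoc : (p : Star R x₁ x₂) → R x₂ x₃ → Linked R (verts p ++ [ x₃ ])
linked-snoc ε       r = r ∷ [-]
linked-snoc (r′ ◅ ε) r = r′ ∷ r ∷ [-]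
linked-snoc (r′ ◅ p@(_ ◅ _)) r = r′ ∷ linked-snoc p r

simplify : ∀ {n} {R : Fin n → Fin n → Set} {a b} → Star R a b → Σ[ q ∈ Star R a b ] Unique (verts q)
simplify ε = ε , ([] ∷ [])
simplify {a = a} (r ◅ p) with simplify p
... | q , unique with Any.any? (a Finₚ.≟_) (verts q)
...   | yes a∈q = let (q′ , unique′) = suffixFrom q a∈q in q′ , unique′ unique
...   | no  a∉q = (r ◅ q) , (Allₚ.¬Any⇒All¬ _ a∉q ∷ unique)

edgeTerm : ∀ {n} → (Fin n → Fin n → Bool) → Fin n → Fin n → ℕ
edgeTerm E u v = indicator ((toℕ u <ᵇ toℕ v) ∧ E u v)

countEdges-sum : ∀ {n} (E : Fin n → Fin n → Bool) → countEdges E ≡ sum (λ u → sum (edgeTerm E u))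
countEdges-sum {n} E = trans (sum-map-allFin (λ u → ListAction.sum (map (edgeTerm E u) (allFin n))))
                              (sum-cong-≗ (λ u → sum-map-allFin (edgeTerm E u)))

countEdges-mono : ∀ {n} (E F : Fin n → Fin n → Bool) → (∀ u v → E u v ≡ true → F u v ≡ true) →
  countEdges E ≤ countEdges F
countEdges-mono E F E⊆F = subst₂ _≤_ (sym (countEdges-sum E)) (sym (countEdges-sum F))
  (sum-mono-≤ λ u → sum-mono-≤ λ v → indicator-mono (∧-mono (toℕ u <ᵇ toℕ v) (E⊆F u v)))
  where
  ∧-mono : ∀ c {a b : Bool} → (a ≡ true → b ≡ true) → c ∧ a ≡ true → c ∧ b ≡ true
  ∧-mono true  a⇒b = a⇒b
  ∧-mono false a⇒b = id

countEdges≤n² : ∀ {n} (E : Fin n → Fin n → Bool) → countEdges E ≤ n * (n * 1)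
countEdges≤n² {n} E = subst (_≤ n * (n * 1)) (sym (countEdges-sum E))
  (sum-≤-* (λ u → sum (edgeTerm E u)) (n * 1) λ u → sum-≤-* (edgeTerm E u) 1 λ v → indicator≤1 _)

<ᵇ-asym : ∀ m n → (m <ᵇ n) ≡ true → (n <ᵇ m) ≡ false
<ᵇ-asym zero    (suc n) _   = refl
<ᵇ-asym (suc m) (suc n) m<n = <ᵇ-asym m n m<n

<ᵇ-irrefl : ∀ m → (m <ᵇ m) ≡ false
<ᵇ-irrefl zero    = refl
<ᵇ-irrefl (suc m) = <ᵇ-irrefl m

<ᵇ-tri : ∀ m n → m ≢ n → (m <ᵇ n) ≡ true ⊎ (n <ᵇ m) ≡ true
<ᵇ-tri zero    zero    m≢n = contradiction refl m≢n
<ᵇ-tri zero    (suc n) _   = inj₁ refl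
<ᵇ-tri (suc m) zero    _   = inj₂ refl
<ᵇ-tri (suc m) (suc n) m≢n = <ᵇ-tri m n (m≢n ∘ cong suc)

Edge : ℕ → Set
Edge n = Fin n × Fin n

module EdgeCounting {n : ℕ} where

  Joins : Edge n → Fin n → Fin n → Set
  Joins (a , b) u v = (a ≡ u × b ≡ v) ⊎ (a ≡ v × b ≡ u)

  -- Abstract for the same reason as _≟ᶠ_.
  abstract
    joins? : ∀ e u v → Dec (Joins e u v)
    joins? (a , b) u v = ((a Finₚ.≟ u) ×-dec (b Finₚ.≟ v)) ⊎-dec ((a Finₚ.≟ v) ×-dec (b Finₚ.≟ u))

  Joins-flip : ∀ {a b u v} → Joins (a , b) u v → Joins (b , a) u v
  Joins-flip (inj₁ (p , q)) = inj₂ (q , p)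
  Joins-flip (inj₂ (p , q)) = inj₁ (q , p)

  Joins-swap : ∀ {e u v} → Joins e u v → Joins e v u
  Joins-swap = Data.Sum.swap

  SameEdge : Edge n → Edge n → Set
  SameEdge e (a′ , b′) = Joins e a′ b′

  hit : Edge n → Fin n → Fin n → ℕ
  hit e = edgeTerm (λ u v → does (joins? e u v))

  total-hit : Edge n → ℕ
  total-hit e = sum (λ u → sum (λ v → hit e u v))

  indicator-∧-false : ∀ b → indicator (b ∧ false) ≡ 0
  indicator-∧-false b rewrite Boolₚ.∧-zeroʳ b = refl

  total-hit-< : ∀ lo hi → (toℕ lo <ᵇ toℕ hi) ≡ true → total-hit (lo , hi) ≡ 1
  total-hit-< lo hi lo<hi = trans (sum-single (λ u → sum (hit (lo , hi) u)) lo other-u)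
                          (trans (sum-single (hit (lo , hi) lo) hi other-v) hit-lo-hi)
    where
    lo≢hi : lo ≢ hi
    lo≢hi refl = contradiction (trans (sym lo<hi) (<ᵇ-irrefl (toℕ lo))) λ ()
    other-u : ∀ u → u ≢ lo → sum (λ v → hit (lo , hi) u v) ≡ 0
    other-u u u≢lo = sum-zero (hit (lo , hi) u) zero-v
      where
      zero-v : ∀ v → hit (lo , hi) u v ≡ 0
      zero-v v with joins? (lo , hi) u v
      ... | no _ = indicator-∧-false (toℕ u <ᵇ toℕ v)
      ... | yes (inj₁ (lo≡u , _)) = contradiction (sym lo≡u) u≢lo
      ... | yes (inj₂ (refl , refl)) rewrite <ᵇ-asym (toℕ lo) (toℕ hi) lo<hi = refl
    other-v : ∀ v → v ≢ hi → hit (lo , hi) lo v ≡ 0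
    other-v v v≢hi with joins? (lo , hi) lo v
    ... | no _ = indicator-∧-false (toℕ lo <ᵇ toℕ v)
    ... | yes (inj₁ (_ , hi≡v)) = contradiction (sym hi≡v) v≢hi
    ... | yes (inj₂ (_ , hi≡lo)) = contradiction (sym hi≡lo) lo≢hi
    hit-lo-hi : hit (lo , hi) lo hi ≡ 1
    hit-lo-hi rewrite dec-true (joins? (lo , hi) lo hi) (inj₁ (refl , refl)) | lo<hi = refl

  joins-flip : ∀ a b u v → does (joins? (a , b) u v) ≡ does (joins? (b , a) u v)
  joins-flip a b u v = does-⇔ (mk⇔ Joins-flip Joins-flip) (joins? (a , b) u v) (joins? (b , a) u v)

  total-hit-≢ : ∀ a b → a ≢ b → total-hit (a , b) ≡ 1
  total-hit-≢ a b a≢b with <ᵇ-tri (toℕ a) (toℕ b) (a≢b ∘ Finₚ.toℕ-injective)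
  ... | inj₁ a<b = total-hit-< a b a<b
  ... | inj₂ b<a = trans (sum-cong-≗ λ u → sum-cong-≗ λ v →
                                 cong (λ j → indicator ((toℕ u <ᵇ toℕ v) ∧ j)) (joins-flip a b u v))
                         (total-hit-< b a b<a)

  total-hit≤1 : ∀ e → total-hit e ≤ 1
  total-hit≤1 (a , b) with a Finₚ.≟ b
  ... | no a≢b = ≤-reflexive (total-hit-≢ a b a≢b)
  ... | yes refl = ≤-trans (≤-reflexive (sum-zero (λ u → sum (hit (a , a) u)) λ u → sum-zero (hit (a , a) u) (loop u))) z≤n
    where
    loop : ∀ u v → hit (a , a) u v ≡ 0
    loop u v with joins? (a , a) u v
    ... | no _ = indicator-∧-false (toℕ u <ᵇ toℕ v)
    ... | yes (inj₁ (refl , refl)) rewrite <ᵇ-irrefl (toℕ u) = refl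
    ... | yes (inj₂ (refl , refl)) rewrite <ᵇ-irrefl (toℕ u) = refl

  private
    Σₗ : List (Edge n) → (Edge n → ℕ) → ℕ
    Σₗ L g = ListAction.sum (map g L)

    sum-Σₗ : ∀ {m} L (g : Fin m → Edge n → ℕ) → sum (λ i → Σₗ L (g i)) ≡ Σₗ L (λ e → sum (λ i → g i e))
    sum-Σₗ {m} [] g = sum-replicate-zero m
    sum-Σₗ (e ∷ L) g =
      trans (∑-distrib-+ (λ i → g i e) (λ i → Σₗ L (g i))) (cong (sum (λ i → g i e) +_) (sum-Σₗ L g))

    Σₗ≤length : ∀ L (g : Edge n → ℕ) → (∀ e → g e ≤ 1) → Σₗ L g ≤ length L
    Σₗ≤length []      g g≤1 = z≤n
    Σₗ≤length (e ∷ L) g g≤1 = +-mono-≤ (g≤1 e) (Σₗ≤length L g g≤1)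

    total-hits : ∀ L → sum (λ u → sum (λ v → Σₗ L (λ e → hit e u v))) ≡ Σₗ L total-hit
    total-hits L = trans (sum-cong-≗ λ u → sum-Σₗ L (λ v e → hit e u v)) (sum-Σₗ L (λ u e → sum (hit e u)))

  joins-unique : ∀ e e′ {u v} → Joins e u v → Joins e′ u v → SameEdge e e′
  joins-unique _ _ (inj₁ (refl , refl)) (inj₁ (refl , refl)) = inj₁ (refl , refl)
  joins-unique _ _ (inj₁ (refl , refl)) (inj₂ (refl , refl)) = inj₂ (refl , refl)
  joins-unique _ _ (inj₂ (refl , refl)) (inj₁ (refl , refl)) = inj₂ (refl , refl)
  joins-unique _ _ (inj₂ (refl , refl)) (inj₂ (refl , refl)) = inj₁ (refl , refl)

  others-miss : ∀ e {u v} L → All (λ e′ → ¬ SameEdge e e′) L → Joins e u v → Σₗ L (λ e′ → hit e′ u v) ≡ 0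
  others-miss e []       _            _ = refl
  others-miss e {u} {v} (e′ ∷ L) (e≠e′ ∷ e≠L) j with joins? e′ u v
  ... | yes j′ = contradiction (joins-unique e e′ j j′) e≠e′
  ... | no _ rewrite Boolₚ.∧-zeroʳ (toℕ u <ᵇ toℕ v) = others-miss e L e≠L j

  increasing⇒distinct : ∀ (h : Fin n → ℕ) {L} → All (λ e → h (proj₁ e) < h (proj₂ e)) L →
    AllPairs (λ e e′ → h (proj₂ e) < h (proj₂ e′)) L → AllPairs (λ e e′ → ¬ SameEdge e e′) L
  increasing⇒distinct h []            []              = []
  increasing⇒distinct h (lo<hi ∷ ups) (hi<his ∷ sorted) =
    All.map (λ hi<hi′ → λ { (inj₁ (_ , e)) → <-irrefl (cong h e) hi<hi′
                          ; (inj₂ (e , _)) → <-irrefl (cong h e) (<-trans lo<hi hi<hi′) }) hi<his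
    ∷ increasing⇒distinct h ups sorted

  module _ (E : Fin n → Fin n → Bool) (E-sym : ∀ a b → E a b ≡ E b a) where

    joins-E : ∀ e {u v} → E (proj₁ e) (proj₂ e) ≡ true → Joins e u v → E u v ≡ true
    joins-E e Ee (inj₁ (refl , refl)) = Ee
    joins-E e Ee (inj₂ (refl , refl)) = trans (E-sym _ _) Ee

    hits≤edge : ∀ L → All (λ e → E (proj₁ e) (proj₂ e) ≡ true) L → AllPairs (λ e e′ → ¬ SameEdge e e′) L →
      ∀ u v → Σₗ L (λ e → hit e u v) ≤ edgeTerm E u v
    hits≤edge []      _          _              u v = z≤n
    hits≤edge (e ∷ L) (Ee ∷ EL) (e≠L ∷ distinct) u v with joins? e u v
    ... | no _ rewrite Boolₚ.∧-zeroʳ (toℕ u <ᵇ toℕ v) = hits≤edge L EL distinct u v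
    ... | yes j rewrite others-miss e L e≠L j | joins-E e Ee j with toℕ u <ᵇ toℕ v
    ...   | true  = ≤-refl
    ...   | false = ≤-refl

    length≤countEdges : ∀ L → All (λ e → E (proj₁ e) (proj₂ e) ≡ true) L → All (λ e → proj₁ e ≢ proj₂ e) L →
      AllPairs (λ e e′ → ¬ SameEdge e e′) L → length L ≤ countEdges E
    length≤countEdges L EL loopless distinct = begin
      length L                                         ≡⟨ each-once L loopless ⟨
      Σₗ L total-hit                                   ≡⟨ total-hits L ⟨
      sum (λ u → sum (λ v → Σₗ L (λ e → hit e u v)))   ≤⟨ sum-mono-≤ (sum-mono-≤ ∘ hits≤edge L EL distinct) ⟩
      sum (λ u → sum (edgeTerm E u))                   ≡⟨ countEdges-sum E ⟨
      countEdges E                                     ∎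
      where
      open ≤-Reasoning
      each-once : ∀ L → All (λ e → proj₁ e ≢ proj₂ e) L → Σₗ L total-hit ≡ length L
      each-once []            _              = refl
      each-once ((a , b) ∷ L) (a≢b ∷ loopless) = cong₂ _+_ (total-hit-≢ a b a≢b) (each-once L loopless)

  countEdges≤length : (E : Fin n → Fin n → Bool) (L : List (Edge n)) →
    (∀ u v → E u v ≡ true → Any (λ e → Joins e u v) L) → countEdges E ≤ length L
  countEdges≤length E L covered = begin
    countEdges E                                     ≡⟨ countEdges-sum E ⟩
    sum (λ u → sum (edgeTerm E u))                   ≤⟨ sum-mono-≤ (λ u → sum-mono-≤ (edge≤hits u)) ⟩
    sum (λ u → sum (λ v → Σₗ L (λ e → hit e u v)))   ≡⟨ total-hits L ⟩
    Σₗ L total-hit                                   ≤⟨ Σₗ≤length L total-hit total-hit≤1 ⟩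
    length L                                         ∎
    where
    open ≤-Reasoning
    edge≤hits : ∀ u v → edgeTerm E u v ≤ Σₗ L (λ e → hit e u v)
    edge≤hits u v with toℕ u <ᵇ toℕ v | E u v in Euv
    ... | false | _     = z≤n
    ... | true  | false = z≤n
    ... | true  | true  = go L (covered u v Euv)
      where
      go : ∀ L → Any (λ e → Joins e u v) L → 1 ≤ Σₗ L (λ e → indicator (does (joins? e u v)))
      go (e ∷ L) (here j) rewrite dec-true (joins? e u v) j = s≤s z≤n
      go (e ∷ L) (there j) = ≤-trans (go L j) (m≤n+m _ _)

-- The induction step of Tree.shrink: A, B, C and Z are the distances of W, of W with one
-- vertex deleted, of S′, and of the final set.
shrink-step-arith : ∀ j d A B C Z →
  suc (suc j + d) * A + C ≤ suc (suc j + d) * B + A →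
  suc j * B + d * C ≤ (suc j + d) * Z →
  suc j * A + suc d * C ≤ (suc j + suc d) * Z
shrink-step-arith j d A B C Z one-step rest =
  subst (λ z → k * A + suc d * C ≤ z * Z) (sym (+-suc k d)) (*-cancelˡ-≤ m chain)
  where
  open +-*-Solver
  k m : ℕ
  k = suc j
  m = k + d
  one-step′ : m * A + C ≤ suc m * B
  one-step′ = +-cancelˡ-≤ A _ _ (subst₂ _≤_ (+-assoc A (m * A) C) (+-comm (suc m * B) A) one-step)
  chain : m * (k * A + suc d * C) ≤ m * (suc m * Z)
  chain = begin
    m * (k * A + suc d * C)              ≡⟨ solve 4 (λ J d A C → (J :+ d) :* (J :* A :+ (con 1 :+ d) :* C)
                                              := J :* ((J :+ d) :* A :+ C) :+ (con 1 :+ (J :+ d)) :* (d :* C)) refl k d A C ⟩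
    k * (m * A + C) + suc m * (d * C)    ≤⟨ +-monoˡ-≤ (suc m * (d * C)) (*-monoʳ-≤ k one-step′) ⟩
    k * (suc m * B) + suc m * (d * C)    ≡⟨ solve 5 (λ J m B d C → J :* ((con 1 :+ m) :* B) :+ (con 1 :+ m) :* (d :* C)
                                              := (con 1 :+ m) :* (J :* B :+ d :* C)) refl k m B d C ⟩
    suc m * (k * B + d * C)              ≤⟨ *-monoʳ-≤ (suc m) rest ⟩
    suc m * (m * Z)                      ≡⟨ solve 2 (λ m Z → (con 1 :+ m) :* (m :* Z) := m :* ((con 1 :+ m) :* Z)) refl m Z ⟩
    m * (suc m * Z)                      ∎
    where open ≤-Reasoning

union-bound-arith : ∀ J d e A A′ C Z → d + e ≡ 3 → A ≤ A′ → 2 ≤ C → C ≤ Z →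
  J * A′ + d * C ≤ (J + d) * Z → J * A + 6 ≤ (3 + J) * Z
union-bound-arith J d e A A′ C Z d+e≡3 A≤A′ 2≤C C≤Z shrunk = begin
  J * A + 6                  ≤⟨ +-mono-≤ (*-monoʳ-≤ J A≤A′) (*-monoʳ-≤ 3 2≤C) ⟩
  J * A′ + 3 * C             ≡⟨ cong (λ t → J * A′ + t * C) (sym d+e≡3) ⟩
  J * A′ + (d + e) * C       ≡⟨ solve 5 (λ J A′ d e C → J :* A′ :+ (d :+ e) :* C
                                                      := J :* A′ :+ d :* C :+ e :* C) refl J A′ d e C ⟩
  J * A′ + d * C + e * C     ≤⟨ +-mono-≤ shrunk (*-monoʳ-≤ e C≤Z) ⟩
  (J + d) * Z + e * Z        ≡⟨ solve 4 (λ J d e Z → (J :+ d) :* Z :+ e :* Z := (J :+ (d :+ e)) :* Z) refl J d e Z ⟩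
  (J + (d + e)) * Z          ≡⟨ cong (λ t → (J + t) * Z) d+e≡3 ⟩
  (J + 3) * Z                ≡⟨ cong (_* Z) (+-comm J 3) ⟩
  (3 + J) * Z                ∎
  where
  open ≤-Reasoning
  open +-*-Solver

¬¬-∀-Fin : ∀ {m} {P : Fin m → Set} → (∀ i → ¬ ¬ P i) → ¬ ¬ (∀ i → P i)
¬¬-∀-Fin {zero}  ¬¬P k = k λ ()
¬¬-∀-Fin {suc m} {P} ¬¬P k =
  ¬¬P zero λ P₀ → ¬¬-∀-Fin {m} {P ∘ suc} (¬¬P ∘ suc) λ Pₛ → k λ { zero → P₀ ; (suc i) → Pₛ i }

¬¬-Dec-≤ : (P : ℕ → Set) (B : ℕ) → ¬ ¬ (∀ e → e ≤ B → Dec (P e))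
¬¬-Dec-≤ P B k = ¬¬-∀-Fin {suc B} {λ i → Dec (P (toℕ i))} (λ _ → ¬¬-excluded-middle) λ dec →
  k λ e e≤B → subst (Dec ∘ P) (Finₚ.toℕ-fromℕ< (s≤s e≤B)) (dec (fromℕ< (s≤s e≤B)))

bounded-max : (P : ℕ → Set) (B : ℕ) → (∀ e → e ≤ B → Dec (P e)) → (∀ e → P e → e ≤ B) →
  ∀ e₀ → P e₀ → Σ[ e ∈ ℕ ] P e × (∀ e′ → P e′ → e′ ≤ e)
bounded-max P B P? bounded e₀ Pe₀ = search B ≤-refl (λ e B<e Pe → <⇒≱ B<e (bounded e Pe))
  where
  search : ∀ t → t ≤ B → (∀ e → t < e → ¬ P e) → Σ[ e ∈ ℕ ] P e × (∀ e′ → P e′ → e′ ≤ e)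
  search t t≤B above with P? t t≤B
  ... | yes Pt = t , Pt , λ e′ Pe′ → ≮⇒≥ (λ t<e′ → above e′ t<e′ Pe′)
  search zero    t≤B above | no ¬P0 = ⊥-elim (none e₀ Pe₀)
    where
    none : ∀ e → ¬ P e
    none zero    = ¬P0
    none (suc e) = above (suc e) (s≤s z≤n)
  search (suc t) t≤B above | no ¬Pt = search t (<⇒≤ t≤B) λ e t<e → case (m≤n⇒m<n∨m≡n t<e)
    where
    case : ∀ {e} → suc t < e ⊎ suc t ≡ e → ¬ P e
    case (inj₁ t+1<e) = above _ t+1<e
    case (inj₂ refl)  = ¬Pt

-- Steiner distances in trees

module _ {n : ℕ} (T : Graph n) where

  AdjAvoiding : Fin n → Fin n → Fin n → Fin n → Set
  AdjAvoiding u v a b = Adj T a b × ¬ EdgeCounting.Joins (a , b) u v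

  ReachAvoiding : Fin n → Fin n → Fin n → Fin n → Set
  ReachAvoiding u v = Star (AdjAvoiding u v)

module Tree {n : ℕ} (T : Graph n) (conn : Connected T) (acyc : Acyclic T)
  (adj? : ∀ u v → Dec (Adj T u v)) (reach? : ∀ u v a b → Dec (ReachAvoiding T u v a b)) where

  open EdgeCounting {n}

  Reach∖ : Fin n → Fin n → Fin n → Fin n → Set
  Reach∖ = ReachAvoiding T

  reverse∖ : ∀ {u v a b} → Reach∖ u v a b → Reach∖ u v b a
  reverse∖ = reverse λ { {a} {b} (ab , ¬uv) → sym-adj T a b ab , ¬uv ∘ Joins-flip }

  swap∖ : ∀ {u v a b} → Reach∖ u v a b → Reach∖ v u a b
  swap∖ = Star-map λ (ab , ¬uv) → ab , ¬uv ∘ Joins-swap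

  avoidingʳ : ∀ {u v x y} (p : Star (Adj T) x y) → ¬ v ∈ₗ verts p → Reach∖ u v x y
  avoidingʳ ε v∉p = ε
  avoidingʳ {u} {v} (_◅_ {i = x} {j = c} xc p) v∉p = (xc , ¬uv) ◅ avoidingʳ p (v∉p ∘ there)
    where
    ¬uv : ¬ Joins (x , c) u v
    ¬uv (inj₁ (_ , c≡v)) = v∉p (there (subst (_∈ₗ verts p) c≡v (here refl)))
    ¬uv (inj₂ (x≡v , _)) = v∉p (here (sym x≡v))

  avoidingˡ : ∀ {u v x y} (p : Star (Adj T) x y) → ¬ u ∈ₗ verts p → Reach∖ u v x y
  avoidingˡ p u∉p = swap∖ (avoidingʳ p u∉p)

  edge-is-bridge : ∀ {u v} → Adj T u v → ¬ Reach∖ u v u v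
  edge-is-bridge {u} {v} uv r with simplify r
  ... | ε , _ = irrefl T u uv
  ... | (r₁ ◅ ε) , _ = proj₂ r₁ (inj₁ (refl , refl))
  ... | (_◅_ {j = c} r₁ (_◅_ {j = d} r₂ q)) , unique =
    acyc u (c ∷ d ∷ inner q) (s≤s (s≤s z≤n) , unique , cycle)
    where
    cycle : Linked (Adj T) (u ∷ (c ∷ d ∷ inner q) ++ [ u ])
    cycle = subst (λ l → Linked (Adj T) (u ∷ l ++ [ u ])) (inner-map proj₁ (r₁ ◅ r₂ ◅ q))
                  (linked-snoc (Star-map proj₁ (r₁ ◅ r₂ ◅ q)) (sym-adj T u v uv))

  side : ∀ {u v} → Adj T u v → ∀ w → Reach∖ u v u w ⊎ Reach∖ u v v w
  side {u} {v} uv w = go (inj₁ ε) (conn u w)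
    where
    go : ∀ {x y} → Reach∖ u v u x ⊎ Reach∖ u v v x → Star (Adj T) x y → Reach∖ u v u y ⊎ Reach∖ u v v y
    go h ε = h
    go {x} h (_◅_ {j = c} xc p) with joins? (x , c) u v
    ... | yes (inj₁ (_ , refl)) = go (inj₂ ε) p
    ... | yes (inj₂ (_ , refl)) = go (inj₁ ε) p
    ... | no ¬uv with h
    ...   | inj₁ ux = go (inj₁ (ux ◅◅ ((xc , ¬uv) ◅ ε))) p
    ...   | inj₂ vx = go (inj₂ (vx ◅◅ ((xc , ¬uv) ◅ ε))) p

  Separates : (Fin n → Bool) → Fin n → Fin n → Set
  Separates W u v = (Σ[ w ∈ Fin n ] W w ≡ true × Reach∖ u v v w) × (Σ[ w ∈ Fin n ] W w ≡ true × Reach∖ u v u w)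

  separates? : ∀ W u v → Dec (Separates W u v)
  separates? W u v = Finₚ.any? (λ w → (W w Boolₚ.≟ true) ×-dec reach? u v v w)
               ×-dec Finₚ.any? (λ w → (W w Boolₚ.≟ true) ×-dec reach? u v u w)

  separates-sym : ∀ {W u v} → Separates W u v → Separates W v u
  separates-sym ((w₁ , W₁ , r₁) , (w₂ , W₂ , r₂)) = (w₂ , W₂ , swap∖ r₂) , (w₁ , W₁ , swap∖ r₁)

  separates-mono : ∀ {W W′} → W ⊆ᵇ W′ → ∀ {u v} → Separates W u v → Separates W′ u v
  separates-mono W⊆W′ ((w₁ , W₁ , r₁) , (w₂ , W₂ , r₂)) =
    (w₁ , W⊆W′ _ W₁ , r₁) , (w₂ , W⊆W′ _ W₂ , r₂)

  cut : (Fin n → Bool) → Fin n → Fin n → Bool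
  cut W u v = does (adj? u v ×-dec separates? W u v)

  cut⇒ : ∀ {W u v} → cut W u v ≡ true → Adj T u v × Separates W u v
  cut⇒ {W} {u} {v} = does⇒ (adj? u v ×-dec separates? W u v)

  ⇒cut : ∀ {W u v} → Adj T u v → Separates W u v → cut W u v ≡ true
  ⇒cut {W} {u} {v} uv s = dec-true (adj? u v ×-dec separates? W u v) (uv , s)

  ¬separates : ∀ {W u v} → Adj T u v → cut W u v ≡ false → ¬ Separates W u v
  ¬separates {W} uv e s = contradiction (trans (sym e) (⇒cut {W} uv s)) λ ()

  cut-sym : ∀ W u v → cut W u v ≡ cut W v u
  cut-sym W u v = does-⇔ (mk⇔ flip flip) (adj? u v ×-dec separates? W u v) (adj? v u ×-dec separates? W v u)
    where
    flip : ∀ {u v} → Adj T u v × Separates W u v → Adj T v u × Separates W v u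
    flip {u} {v} (uv , s) = sym-adj T u v uv , separates-sym s

  cut-mono : ∀ {W W′} → W ⊆ᵇ W′ → ∀ u v → cut W u v ≡ true → cut W′ u v ≡ true
  cut-mono {W} {W′} W⊆W′ u v e = let (uv , s) = cut⇒ {W} e in ⇒cut {W′} uv (separates-mono W⊆W′ s)

  dist : (Fin n → Bool) → ℕ
  dist W = countEdges (cut W)

  dist-mono : ∀ {W W′} → W ⊆ᵇ W′ → dist W ≤ dist W′
  dist-mono {W} {W′} W⊆W′ = countEdges-mono (cut W) (cut W′) (cut-mono W⊆W′)

  -- An edge separating W is a bridge between two vertices of W, so no connected edge set
  -- spanning W can miss it.
  cut⊆connected : (W : Fin n → Bool) (F : Fin n → Fin n → Bool) → (∀ a b → F a b ≡ F b a) →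
    (∀ a b → F a b ≡ true → Adj T a b) →
    (∀ w₁ w₂ → W w₁ ≡ true → W w₂ ≡ true → Star (λ a b → F a b ≡ true) w₁ w₂) →
    ∀ u v → cut W u v ≡ true → F u v ≡ true
  cut⊆connected W F F-sym F-adj F-conn u v e with F u v in Fuv | cut⇒ {W} e
  ... | true  | _ = refl
  ... | false | uv , ((w₁ , W₁ , v⇝w₁) , (w₂ , W₂ , u⇝w₂)) =
    ⊥-elim (edge-is-bridge uv (reverse∖ (v⇝w₁ ◅◅ Star-map avoid (F-conn w₁ w₂ W₁ W₂) ◅◅ reverse∖ u⇝w₂)))
    where
    avoid : ∀ {x y} → F x y ≡ true → AdjAvoiding T u v x y
    avoid {x} {y} Fxy = F-adj x y Fxy , λ
      { (inj₁ (refl , refl)) → contradiction (trans (sym Fuv) Fxy) λ ()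
      ; (inj₂ (refl , refl)) → contradiction (trans (sym Fuv) (trans (F-sym u v) Fxy)) λ () }

  CutPath : (Fin n → Bool) → Fin n → Fin n → Set
  CutPath W = Star (λ a b → cut W a b ≡ true)

  -- Walking along a path x ⇝ w₂ whose vertices avoid a path pre : x ⇝ w₁ back to W,
  -- every edge crossed separates w₁ from w₂.
  path⇒cutPath : ∀ W {w₁ w₂} → W w₁ ≡ true → W w₂ ≡ true → ∀ {x}
    (pre : Star (Adj T) x w₁) (p : Star (Adj T) x w₂) → Unique (verts pre) → Unique (verts p) →
    (∀ {z} → z ∈ₗ inner pre → ¬ z ∈ₗ verts p) → CutPath W x w₂
  path⇒cutPath W W₁ W₂ pre ε _ _ _ = ε
  path⇒cutPath W {w₁} {w₂} W₁ W₂ {x} pre (_◅_ {j = c} xc p) unique-pre (x∉p ∷ unique-p) disjoint =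
    ⇒cut {W} xc separated ◅
    path⇒cutPath W W₁ W₂ (sym-adj T x c xc ◅ pre) p (Allₚ.¬Any⇒All¬ _ c∉pre ∷ unique-pre) unique-p disjoint′
    where
    x∉p′ : ¬ x ∈ₗ verts p
    x∉p′ = Allₚ.All¬⇒¬Any x∉p
    c∉pre : ¬ c ∈ₗ verts pre
    c∉pre (here refl) = x∉p′ (here refl)
    c∉pre (there c∈pre) = disjoint c∈pre (there (here refl))
    separated : Separates W x c
    separated = (w₂ , W₂ , avoidingˡ p x∉p′) , (w₁ , W₁ , avoidingʳ pre c∉pre)
    disjoint′ : ∀ {z} → z ∈ₗ verts pre → ¬ z ∈ₗ verts p
    disjoint′ (here refl) = x∉p′
    disjoint′ (there z∈pre) z∈p = disjoint z∈pre (there z∈p)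

  cutPath-between : ∀ W {w₁ w₂} → W w₁ ≡ true → W w₂ ≡ true → CutPath W w₁ w₂
  cutPath-between W W₁ W₂ with simplify (conn _ _)
  ... | q , unique = path⇒cutPath W W₁ W₂ ε q ([] ∷ []) unique λ ()

  cut⇒cutPath : ∀ W {u v} → cut W u v ≡ true → Σ[ w ∈ Fin n ] W w ≡ true × CutPath W u w
  cut⇒cutPath W {u} {v} e with cut⇒ {W} e
  ... | uv , ((w₁ , W₁ , v⇝w₁) , (w₂ , W₂ , u⇝w₂)) with simplify v⇝w₁ | simplify u⇝w₂
  ...   | q₁ , unique₁ | q₂ , unique₂ =
    w₂ , W₂ , path⇒cutPath W W₁ W₂ (uv ◅ p₁) p₂ (Allₚ.¬Any⇒All¬ _ u∉p₁ ∷ unique-p₁) unique-p₂ disjoint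
    where
    p₁ : Star (Adj T) v w₁
    p₁ = Star-map proj₁ q₁
    p₂ : Star (Adj T) u w₂
    p₂ = Star-map proj₁ q₂
    unique-p₁ : Unique (verts p₁)
    unique-p₁ = subst (λ l → Unique (v ∷ l)) (sym (inner-map proj₁ q₁)) unique₁
    unique-p₂ : Unique (verts p₂)
    unique-p₂ = subst (λ l → Unique (u ∷ l)) (sym (inner-map proj₁ q₂)) unique₂
    in-q₁ : ∀ {z} → z ∈ₗ verts p₁ → z ∈ₗ verts q₁
    in-q₁ = subst (λ l → _ ∈ₗ (v ∷ l)) (inner-map proj₁ q₁)
    in-q₂ : ∀ {z} → z ∈ₗ verts p₂ → z ∈ₗ verts q₂
    in-q₂ = subst (λ l → _ ∈ₗ (u ∷ l)) (inner-map proj₁ q₂)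
    u∉p₁ : ¬ u ∈ₗ verts p₁
    u∉p₁ u∈p₁ = edge-is-bridge uv (reverse∖ (prefixTo q₁ (in-q₁ u∈p₁)))
    disjoint : ∀ {z} → z ∈ₗ verts p₁ → ¬ z ∈ₗ verts p₂
    disjoint z∈p₁ z∈p₂ = edge-is-bridge uv (prefixTo q₂ (in-q₂ z∈p₂) ◅◅ reverse∖ (prefixTo q₁ (in-q₁ z∈p₁)))

  cutPath-reverse : ∀ W {a b} → CutPath W a b → CutPath W b a
  cutPath-reverse W = reverse (λ {a} {b} e → trans (cut-sym W b a) e)

  cutVertex : (Fin n → Bool) → Fin n → Bool
  cutVertex W u = W u ∨ does (Finₚ.any? (λ v → cut W u v Boolₚ.≟ true))

  cutVertex⇒cutPath : ∀ W {u} → cutVertex W u ≡ true → Σ[ w ∈ Fin n ] W w ≡ true × CutPath W u w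
  cutVertex⇒cutPath W {u} e with W u in Wu
  ... | true  = u , Wu , ε
  ... | false = cut⇒cutPath W (proj₂ (does⇒ (Finₚ.any? (λ v → cut W u v Boolₚ.≟ true)) e))

  steinerTree : (Fin n → Bool) → Subgraph T
  steinerTree W = record
    { V     = vtabulate (cutVertex W)
    ; E     = cut W
    ; E-sym = cut-sym W
    ; E-adj = λ u v e → proj₁ (cut⇒ {W} e)
    ; E-V   = λ u v e → ∈-tabulate⁺ (cutVertex W) (endpoint u v e) }
    where
    endpoint : ∀ u v → cut W u v ≡ true → cutVertex W u ≡ true
    endpoint u v e with W u
    ... | true  = refl
    ... | false = dec-true (Finₚ.any? (λ v → cut W u v Boolₚ.≟ true)) (v , e)

  steinerTree-connected : ∀ W → ConnectedSub (steinerTree W)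
  steinerTree-connected W u v u∈ v∈
    with cutVertex⇒cutPath W (∈-tabulate⁻ (cutVertex W) u∈) | cutVertex⇒cutPath W (∈-tabulate⁻ (cutVertex W) v∈)
  ... | w₁ , W₁ , u⇝w₁ | w₂ , W₂ , v⇝w₂ = u⇝w₁ ◅◅ cutPath-between W W₁ W₂ ◅◅ cutPath-reverse W v⇝w₂

  isSteinerDist-dist : (S : Subset n) (W : Fin n → Bool) → (∀ x → x ∈ S → W x ≡ true) →
    (∀ x → W x ≡ true → x ∈ S) → IsSteinerDist T S (dist W)
  isSteinerDist-dist S W S⊆W W⊆S =
    (steinerTree W , steinerTree-connected W , spans , refl) ,
    λ H H-conn S⊆H → countEdges-mono (cut W) (E H) (cut⊆connected W (E H) (E-sym H) (E-adj H)
      λ w₁ w₂ W₁ W₂ → H-conn w₁ w₂ (S⊆H (W⊆S w₁ W₁)) (S⊆H (W⊆S w₂ W₂)))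
    where
    spans : S ⊆ V (steinerTree W)
    spans {x} x∈S = ∈-tabulate⁺ (cutVertex W) (cutVertex-W x (S⊆W x x∈S))
      where
      cutVertex-W : ∀ x → W x ≡ true → cutVertex W x ≡ true
      cutVertex-W x Wx rewrite Wx = refl

  isSteinerDist⇒≡dist : (S : Subset n) (W : Fin n → Bool) → (∀ x → x ∈ S → W x ≡ true) →
    (∀ x → W x ≡ true → x ∈ S) → ∀ d → IsSteinerDist T S d → d ≡ dist W
  isSteinerDist⇒≡dist S W S⊆W W⊆S d ((H , H-conn , S⊆H , H≡d) , min) =
    ≤-antisym (min (steinerTree W) (steinerTree-connected W) (proj₁ (proj₂ (proj₂ (proj₁ tree)))))
              (subst (dist W ≤_) H≡d (proj₂ tree H H-conn S⊆H))
    where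
    tree : IsSteinerDist T S (dist W)
    tree = isSteinerDist-dist S W S⊆W W⊆S

  lookup-steiner : ∀ S → IsSteinerDist T S (dist (lookup S))
  lookup-steiner S = isSteinerDist-dist S (lookup S) (λ _ → []=⇒lookup) (λ x → lookup⇒[]= x S)

  tabulate-steiner : ∀ W → IsSteinerDist T (vtabulate W) (dist W)
  tabulate-steiner W = isSteinerDist-dist (vtabulate W) W (λ _ → ∈-tabulate⁻ W) (λ _ → ∈-tabulate⁺ W)

  lookup-dist : ∀ S d → IsSteinerDist T S d → d ≡ dist (lookup S)
  lookup-dist S = isSteinerDist⇒≡dist S (lookup S) (λ _ → []=⇒lookup) (λ x → lookup⇒[]= x S)

  dist-sum : ∀ W → dist W ≡ sum (λ u → sum (edgeTerm (cut W) u))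
  dist-sum W = countEdges-sum (cut W)

  -- Deleting the vertices of X = W ∖ S′ one at a time; z₀ ∈ S′ is an anchor that is never deleted.
  module Deletion (S′ W : Fin n → Bool) (S′⊆W : S′ ⊆ᵇ W) (z₀ : Fin n) (S′z₀ : S′ z₀ ≡ true) where

    X : Fin n → Bool
    X = W ∖ S′

    z₀≢ : ∀ {s} → X s ≡ true → z₀ ≢ s
    z₀≢ {s} Xs refl = contradiction (trans (sym S′z₀) (∖⇒∉ʳ {X = W} {S′} Xs)) λ ()

    S′⊆W-s : ∀ {s} → X s ≡ true → S′ ⊆ᵇ remove s W
    S′⊆W-s {s} Xs x S′x = ∈-remove {X = W} (S′⊆W x S′x)
      λ { refl → contradiction (trans (sym S′x) (∖⇒∉ʳ {X = W} {S′} Xs)) λ () }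

    -- An edge separating W stops separating after deleting s only if s is the sole vertex
    -- of W on one of its sides; as z₀ is never deleted, this can happen for one s at most.
    deletion-unique : ∀ u v → cut W u v ≡ true → ∀ s t → X s ≡ true → X t ≡ true →
      cut (remove s W) u v ≡ false → cut (remove t W) u v ≡ false → s ≡ t
    deletion-unique u v e s t Xs Xt ¬cut-s ¬cut-t with s Finₚ.≟ t | cut⇒ {W} e
    ... | yes s≡t | _ = s≡t
    ... | no s≢t | uv , ((w₁ , W₁ , v⇝w₁) , (w₂ , W₂ , u⇝w₂)) = go (lonely s ¬cut-s) (lonely t ¬cut-t)
      where
      Wz₀ : W z₀ ≡ true
      Wz₀ = S′⊆W z₀ S′z₀
      stays : ∀ {w} → W w ≡ true → ∀ {s′} → w ≢ s′ → remove s′ W w ≡ true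
      stays Ww w≢s′ = ∈-remove {X = W} Ww w≢s′
      lonely : ∀ s′ → cut (remove s′ W) u v ≡ false → w₁ ≡ s′ ⊎ w₂ ≡ s′
      lonely s′ ¬cut with w₁ Finₚ.≟ s′ | w₂ Finₚ.≟ s′
      ... | yes p | _     = inj₁ p
      ... | no _  | yes p = inj₂ p
      ... | no p  | no q  = ⊥-elim (¬separates uv ¬cut ((w₁ , stays W₁ p , v⇝w₁) , (w₂ , stays W₂ q , u⇝w₂)))
      go : w₁ ≡ s ⊎ w₂ ≡ s → w₁ ≡ t ⊎ w₂ ≡ t → s ≡ t
      go (inj₁ p) (inj₁ q) = trans (sym p) q
      go (inj₂ p) (inj₂ q) = trans (sym p) q
      go (inj₁ refl) (inj₂ refl) with side uv z₀
      ... | inj₁ u⇝z₀ =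
        ⊥-elim (¬separates uv ¬cut-t ((w₁ , stays W₁ s≢t , v⇝w₁) , (z₀ , stays Wz₀ (z₀≢ Xt) , u⇝z₀)))
      ... | inj₂ v⇝z₀ =
        ⊥-elim (¬separates uv ¬cut-s ((z₀ , stays Wz₀ (z₀≢ Xs) , v⇝z₀) , (w₂ , stays W₂ (s≢t ∘ sym) , u⇝w₂)))
      go (inj₂ refl) (inj₁ refl) with side uv z₀
      ... | inj₁ u⇝z₀ =
        ⊥-elim (¬separates uv ¬cut-s ((w₁ , stays W₁ (s≢t ∘ sym) , v⇝w₁) , (z₀ , stays Wz₀ (z₀≢ Xs) , u⇝z₀)))
      ... | inj₂ v⇝z₀ =
        ⊥-elim (¬separates uv ¬cut-t ((z₀ , stays Wz₀ (z₀≢ Xt) , v⇝z₀) , (w₂ , stays W₂ s≢t , u⇝w₂)))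

    deletion-edge : ∀ u v →
      count X * edgeTerm (cut W) u v + edgeTerm (cut S′) u v
        ≤ weightedSum X (λ s → edgeTerm (cut (remove s W)) u v) + edgeTerm (cut W) u v
    deletion-edge u v with toℕ u <ᵇ toℕ v
    ... | false rewrite *-zeroʳ (count X) = z≤n
    ... | true with cut W u v in cutW | cut S′ u v in cutS′
    ...   | false | true  = contradiction (trans (sym cutW) (cut-mono S′⊆W u v cutS′)) λ ()
    ...   | false | false rewrite *-zeroʳ (count X) = z≤n
    ...   | true  | true  rewrite *-identityʳ (count X)
                              | weightedSum-1 X (λ s → indicator (cut (remove s W) u v))
                                  (λ s Xs → cong indicator (cut-mono (S′⊆W-s Xs) u v cutS′)) = ≤-refl
    ...   | true  | false rewrite *-identityʳ (count X) | +-identityʳ (count X) =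
      subst (_≤ weightedSum X (λ s → indicator (cut (remove s W) u v)) + 1)
            (sym (weightedSum-split X (λ s → cut (remove s W) u v)))
            (+-monoʳ-≤ (weightedSum X (λ s → indicator (cut (remove s W) u v)))
               (count≤1 (X ∖ (λ s → cut (remove s W) u v)) λ s t Xs Xt →
                  deletion-unique u v cutW s t (∧-l Xs) (∧-l Xt) (∧-r Xs) (∧-r Xt)))
      where
      ∧-l : ∀ {a b} → a ∧ not b ≡ true → a ≡ true
      ∧-l {true} _ = refl
      ∧-r : ∀ {a b} → a ∧ not b ≡ true → b ≡ false
      ∧-r {true} {false} _ = refl

    deletion-sum : count X * dist W + dist S′ ≤ weightedSum X (λ s → dist (remove s W)) + dist W
    deletion-sum = begin
      count X * dist W + dist S′
        ≡⟨ cong₂ _+_ (trans (cong (count X *_) (dist-sum W)) (*-distribˡ-sum (count X) (λ u → sum (edgeTerm (cut W) u))))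
                     (dist-sum S′) ⟩
      sum (λ u → count X * sum (edgeTerm (cut W) u)) + sum (λ u → sum (edgeTerm (cut S′) u))
        ≡⟨ cong (_+ sum (λ u → sum (edgeTerm (cut S′) u)))
                (sum-cong-≗ λ u → *-distribˡ-sum (count X) (edgeTerm (cut W) u)) ⟩
      sum (λ u → sum (λ v → count X * edgeTerm (cut W) u v)) + sum (λ u → sum (edgeTerm (cut S′) u))
        ≡⟨ sum₂-+ (λ u v → count X * edgeTerm (cut W) u v) (edgeTerm (cut S′)) ⟨
      sum (λ u → sum (λ v → count X * edgeTerm (cut W) u v + edgeTerm (cut S′) u v))
        ≤⟨ sum-mono-≤ (λ u → sum-mono-≤ (deletion-edge u)) ⟩
      sum (λ u → sum (λ v → weightedSum X (λ s → edgeTerm (cut (remove s W)) u v) + edgeTerm (cut W) u v))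
        ≡⟨ sum₂-+ (λ u v → weightedSum X (λ s → edgeTerm (cut (remove s W)) u v)) (edgeTerm (cut W)) ⟩
      sum (λ u → sum (λ v → weightedSum X (λ s → edgeTerm (cut (remove s W)) u v))) + sum (λ u → sum (edgeTerm (cut W) u))
        ≡⟨ cong₂ _+_ (sym (weightedSum-∑∑ X (λ s → edgeTerm (cut (remove s W))))) (sym (dist-sum W)) ⟩
      weightedSum X (λ s → sum (λ u → sum (edgeTerm (cut (remove s W)) u))) + dist W
        ≡⟨ cong (_+ dist W) (sum-cong-≗ λ s → cong (indicator (X s) *_) (dist-sum (remove s W))) ⟨
      weightedSum X (λ s → dist (remove s W)) + dist W ∎
      where
      open ≤-Reasoning
      sum₂-+ : (f g : Fin n → Fin n → ℕ) →
        sum (λ u → sum (λ v → f u v + g u v)) ≡ sum (λ u → sum (f u)) + sum (λ u → sum (g u))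
      sum₂-+ f g = trans (sum-cong-≗ λ u → ∑-distrib-+ (f u) (g u)) (∑-distrib-+ (λ u → sum (f u)) (λ u → sum (g u)))

    deletion-step : 1 ≤ count X →
      Σ[ s ∈ Fin n ] X s ≡ true × count X * dist W + dist S′ ≤ count X * dist (remove s W) + dist W
    deletion-step X≢∅ with weightedSum≤count*max X (λ s → dist (remove s W)) X≢∅
    ... | s , Xs , avg = s , Xs , ≤-trans deletion-sum (+-monoˡ-≤ (dist W) avg)

  shrink : (S′ : Fin n → Bool) (z₀ : Fin n) → S′ z₀ ≡ true → ∀ j d (W : Fin n → Bool) → S′ ⊆ᵇ W →
    count (W ∖ S′) ≡ suc j + d →
    Σ[ W′ ∈ (Fin n → Bool) ] S′ ⊆ᵇ W′ × count (W′ ∖ S′) ≡ suc j ×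
                             suc j * dist W + d * dist S′ ≤ (suc j + d) * dist W′
  shrink S′ z₀ S′z₀ j zero W S′⊆W X≡ =
    W , S′⊆W , trans X≡ (+-identityʳ _) ,
    subst₂ _≤_ (sym (+-identityʳ _)) (cong (_* dist W) (sym (+-identityʳ (suc j)))) ≤-refl
  shrink S′ z₀ S′z₀ j (suc d) W S′⊆W X≡
    with Deletion.deletion-step S′ W S′⊆W z₀ S′z₀ (subst (1 ≤_) (sym X≡) (s≤s z≤n))
  ... | s , Xs , step with shrink S′ z₀ S′z₀ j d (remove s W) (Deletion.S′⊆W-s S′ W S′⊆W z₀ S′z₀ Xs) X-s≡
    where
    X-s≡ : count (remove s W ∖ S′) ≡ suc j + d
    X-s≡ = suc-injective (begin
      suc (count (remove s W ∖ S′)) ≡⟨ cong suc (count-cong (∖-remove W S′ s)) ⟩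
      suc (count (remove s (W ∖ S′))) ≡⟨ count-remove (W ∖ S′) s Xs ⟨
      count (W ∖ S′)                 ≡⟨ X≡ ⟩
      suc j + suc d                  ≡⟨ +-suc (suc j) d ⟩
      suc (suc j + d)                ∎)
      where open ≡-Reasoning
  ...   | W′ , S′⊆W′ , X′≡ , rest = W′ , S′⊆W′ , X′≡ ,
    shrink-step-arith j d (dist W) (dist (remove s W)) (dist S′) (dist W′)
      (subst (λ c → c * dist W + dist S′ ≤ c * dist (remove s W) + dist W) (trans X≡ (+-suc (suc j) d)) step) rest

  first-edge : ∀ {x y} → x ≢ y → Σ[ p ∈ Fin n ] Σ[ q ∈ Fin n ] Adj T p q × Reach∖ p q p x × Reach∖ p q q y
  first-edge {x} {y} x≢y with simplify (conn x y)
  ... | ε , _ = contradiction refl x≢y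
  ... | (_◅_ {j = c} xc q) , (x∉q ∷ _) = x , c , xc , ε , avoidingˡ q (Allₚ.All¬⇒¬Any x∉q)

  two-cut-edges : ∀ S {p₁ q₁ p₂ q₂} → Adj T p₁ q₁ → Adj T p₂ q₂ →
    cut S p₁ q₁ ≡ true → cut S p₂ q₂ ≡ true → ¬ SameEdge (p₁ , q₁) (p₂ , q₂) → 2 ≤ dist S
  two-cut-edges S {p₁} {q₁} {p₂} {q₂} p₁q₁ p₂q₂ e₁ e₂ distinct =
    length≤countEdges (cut S) (cut-sym S) ((p₁ , q₁) ∷ (p₂ , q₂) ∷ []) (e₁ ∷ e₂ ∷ [])
      ((λ { refl → irrefl T p₁ p₁q₁ }) ∷ (λ { refl → irrefl T p₂ p₂q₂ }) ∷ []) ((distinct ∷ []) ∷ [] ∷ [])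

  -- Two distinct edges separate a set with three distinct vertices a, b, c: the first edges
  -- on the paths a ⇝ b and, depending on the side of c, on b ⇝ c or a ⇝ c.
  dist≥2 : ∀ (S : Fin n → Bool) {a b c} → S a ≡ true → S b ≡ true → S c ≡ true →
    a ≢ b → a ≢ c → b ≢ c → 2 ≤ dist S
  dist≥2 S {a} {b} {c} Sa Sb Sc a≢b a≢c b≢c with first-edge a≢b
  ... | p₁ , q₁ , p₁q₁ , p₁⇝a , q₁⇝b with side p₁q₁ c
  ...   | inj₂ q₁⇝c with first-edge b≢c
  ...     | p₂ , q₂ , p₂q₂ , p₂⇝b , q₂⇝c =
    two-cut-edges S p₁q₁ p₂q₂ (⇒cut {S} p₁q₁ ((b , Sb , q₁⇝b) , (a , Sa , p₁⇝a)))
                              (⇒cut {S} p₂q₂ ((c , Sc , q₂⇝c) , (b , Sb , p₂⇝b)))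
      λ { (inj₁ (refl , refl)) → edge-is-bridge p₁q₁ (p₂⇝b ◅◅ reverse∖ q₁⇝b)
        ; (inj₂ (refl , refl)) → edge-is-bridge p₁q₁ (swap∖ q₂⇝c ◅◅ reverse∖ q₁⇝c) }
  dist≥2 S {a} {b} {c} Sa Sb Sc a≢b a≢c b≢c | p₁ , q₁ , p₁q₁ , p₁⇝a , q₁⇝b | inj₁ p₁⇝c with first-edge a≢c
  ...     | p₂ , q₂ , p₂q₂ , p₂⇝a , q₂⇝c =
    two-cut-edges S p₁q₁ p₂q₂ (⇒cut {S} p₁q₁ ((b , Sb , q₁⇝b) , (a , Sa , p₁⇝a)))
                              (⇒cut {S} p₂q₂ ((c , Sc , q₂⇝c) , (a , Sa , p₂⇝a)))
      λ { (inj₁ (refl , refl)) → edge-is-bridge p₁q₁ (p₁⇝c ◅◅ reverse∖ q₂⇝c)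
        ; (inj₂ (refl , refl)) → edge-is-bridge p₁q₁ (p₁⇝a ◅◅ reverse∖ (swap∖ p₂⇝a)) }

  count≡3⇒dist≥2 : ∀ S → count S ≡ 3 → 2 ≤ dist S
  count≡3⇒dist≥2 S ∣S∣ = let (_ , _ , _ , Sa , Sb , Sc , a≢b , a≢c , b≢c) = count≡3⇒three S ∣S∣
                         in dist≥2 S Sa Sb Sc a≢b a≢c b≢c

  dist-submodular : ∀ (S₀ W : Fin n → Bool) z₀ → S₀ z₀ ≡ true → S₀ ⊆ᵇ W → ∀ y →
    dist (insert y W) + dist S₀ ≤ dist W + dist (insert y S₀)
  dist-submodular S₀ W z₀ S₀z₀ S₀⊆W y = subst₂ _≤_ (sums (insert y W) S₀) (sums W (insert y S₀))
    (sum-mono-≤ λ u → subst₂ _≤_ (∑-distrib-+ (edgeTerm (cut (insert y W)) u) (edgeTerm (cut S₀) u))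
                                   (∑-distrib-+ (edgeTerm (cut W) u) (edgeTerm (cut (insert y S₀)) u))
                        (sum-mono-≤ (per-edge u)))
    where
    sums : ∀ A B → sum (λ u → sum (λ v → edgeTerm (cut A) u v) + sum (λ v → edgeTerm (cut B) u v)) ≡ dist A + dist B
    sums A B = trans (∑-distrib-+ (λ u → sum (edgeTerm (cut A) u)) (λ u → sum (edgeTerm (cut B) u)))
                     (sym (cong₂ _+_ (dist-sum A) (dist-sum B)))
    per-edge : ∀ u v → edgeTerm (cut (insert y W)) u v + edgeTerm (cut S₀) u v
                     ≤ edgeTerm (cut W) u v + edgeTerm (cut (insert y S₀)) u v
    per-edge u v with toℕ u <ᵇ toℕ v
    ... | false = z≤n
    ... | true with cut (insert y W) u v in cutW+y
    ...   | false = ≤-trans (indicator-mono (cut-mono S₀⊆W u v)) (m≤m+n _ _)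
    ...   | true with cut W u v in cutW
    ...     | true = +-monoʳ-≤ 1 (indicator-mono (cut-mono (λ z → ∈-insert-old {X = S₀} {y = y}) u v))
    ...     | false with cut S₀ u v in cutS₀
    ...       | true = contradiction (trans (sym cutW) (cut-mono S₀⊆W u v cutS₀)) λ ()
    ...       | false = subst (λ b → 1 ≤ indicator b) (sym (⇒cut {insert y S₀} uv separated)) ≤-refl
      where
      uv : Adj T u v
      uv = proj₁ (cut⇒ {insert y W} cutW+y)
      separated : Separates (insert y S₀) u v
      separated with proj₂ (cut⇒ {insert y W} cutW+y) | side uv z₀
      ... | (w₁ , W₁ , v⇝w₁) , _ | inj₁ u⇝z₀ with insert⇒ {X = W} W₁
      ...   | inj₁ refl = (w₁ , ∈-insert-new {X = S₀} , v⇝w₁) , (z₀ , ∈-insert-old {X = S₀} S₀z₀ , u⇝z₀)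
      ...   | inj₂ W₁′ = ⊥-elim (¬separates uv cutW ((w₁ , W₁′ , v⇝w₁) , (z₀ , S₀⊆W z₀ S₀z₀ , u⇝z₀)))
      separated | _ , (w₂ , W₂ , u⇝w₂) | inj₂ v⇝z₀ with insert⇒ {X = W} W₂
      ...   | inj₁ refl = (z₀ , ∈-insert-old {X = S₀} S₀z₀ , v⇝z₀) , (w₂ , ∈-insert-new {X = S₀} , u⇝w₂)
      ...   | inj₂ W₂′ = ⊥-elim (¬separates uv cutW ((z₀ , S₀⊆W z₀ S₀z₀ , v⇝z₀) , (w₂ , W₂′ , u⇝w₂)))

  dist-≤-+* : ∀ (S₀ : Fin n → Bool) z₀ → S₀ z₀ ≡ true → ∀ x → (∀ y → dist (insert y S₀) ≤ dist S₀ + x) →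
    ∀ r (S : Fin n → Bool) → S₀ ⊆ᵇ S → count (S ∖ S₀) ≡ r → dist S ≤ dist S₀ + r * x
  dist-≤-+* S₀ z₀ S₀z₀ x grow zero S S₀⊆S none = ≤-trans (dist-mono S⊆S₀) (m≤m+n _ _)
    where
    S⊆S₀ : S ⊆ᵇ S₀
    S⊆S₀ z Sz with S₀ z in S₀z
    ... | true  = refl
    ... | false = contradiction (subst (1 ≤_) none (∈⇒count≥1 (S ∖ S₀) z (cong₂ _∧_ Sz (cong not S₀z)))) λ ()
  dist-≤-+* S₀ z₀ S₀z₀ x grow (suc r) S S₀⊆S S∖S₀≡
    with count≥1⇒∃ (S ∖ S₀) (subst (1 ≤_) (sym S∖S₀≡) (s≤s z≤n))
  ... | y , y∈S∖S₀ = begin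
    dist S                    ≤⟨ dist-mono S⊆S-y+y ⟩
    dist (insert y (S-y))     ≤⟨ +-cancelʳ-≤ (dist S₀) _ _ submodular ⟩
    dist (S-y) + x            ≤⟨ +-monoˡ-≤ x (dist-≤-+* S₀ z₀ S₀z₀ x grow r (S-y) S₀⊆S-y S-y∖S₀≡) ⟩
    dist S₀ + r * x + x       ≡⟨ trans (+-assoc (dist S₀) (r * x) x) (cong (dist S₀ +_) (+-comm (r * x) x)) ⟩
    dist S₀ + suc r * x       ∎
    where
    open ≤-Reasoning
    S-y : Fin n → Bool
    S-y = remove y S
    S₀⊆S-y : S₀ ⊆ᵇ S-y
    S₀⊆S-y z S₀z = ∈-remove {X = S} (S₀⊆S z S₀z)
      λ { refl → contradiction (trans (sym S₀z) (∖⇒∉ʳ {X = S} {S₀} y∈S∖S₀)) λ () }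
    S-y∖S₀≡ : count (S-y ∖ S₀) ≡ r
    S-y∖S₀≡ = suc-injective (trans (cong suc (count-cong (∖-remove S S₀ y)))
                (trans (sym (count-remove (S ∖ S₀) y y∈S∖S₀)) S∖S₀≡))
    S⊆S-y+y : S ⊆ᵇ insert y (S-y)
    S⊆S-y+y z Sz with z Finₚ.≟ y
    ... | yes refl = ∈-insert-new {X = S-y}
    ... | no z≢y  = ∈-insert-old {X = S-y} (∈-remove {X = S} Sz z≢y)
    submodular : dist (insert y (S-y)) + dist S₀ ≤ dist (S-y) + x + dist S₀
    submodular = ≤-trans (dist-submodular S₀ (S-y) z₀ S₀z₀ S₀⊆S-y y) (begin
      dist (S-y) + dist (insert y S₀) ≤⟨ +-monoʳ-≤ (dist (S-y)) (grow y) ⟩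
      dist (S-y) + (dist S₀ + x)      ≡⟨ solve 3 (λ a b c → a :+ (b :+ c) := a :+ c :+ b) refl (dist (S-y)) (dist S₀) x ⟩
      dist (S-y) + x + dist S₀        ∎)
      where open +-*-Solver

  -- A walk through all of W is a connected edge set spanning W.
  dist≤len : ∀ {s t} (p : Star (Adj T) s t) (W : Fin n → Bool) → (∀ w → W w ≡ true → w ∈ₗ verts p) →
    dist W ≤ len p
  dist≤len {s} p W W⊆p = begin
    dist W              ≤⟨ countEdges-mono (cut W) onP (cut⊆connected W onP onP-sym onP-adj spans) ⟩
    countEdges onP      ≤⟨ countEdges≤length onP (steps p) (λ u v → does⇒ (onP? u v)) ⟩
    length (steps p)    ≡⟨ length-steps p ⟩
    len p               ∎
    where
    open ≤-Reasoning
    onP? : ∀ u v → Dec (Any (λ e → Joins e u v) (steps p))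
    onP? u v = Any.any? (λ e → joins? e u v) (steps p)
    onP : Fin n → Fin n → Bool
    onP u v = does (onP? u v)
    onP-sym : ∀ u v → onP u v ≡ onP v u
    onP-sym u v = does-⇔ (mk⇔ (Any.map Joins-swap) (Any.map Joins-swap)) (onP? u v) (onP? v u)
    steps-adj : ∀ {a b} (q : Star (Adj T) a b) → All (λ e → Adj T (proj₁ e) (proj₂ e)) (steps q)
    steps-adj ε       = []
    steps-adj (r ◅ q) = r ∷ steps-adj q
    onP-adj : ∀ u v → onP u v ≡ true → Adj T u v
    onP-adj u v e = All.lookupWith joined (steps-adj p) (does⇒ (onP? u v) e)
      where
      joined : ∀ {e} → Adj T (proj₁ e) (proj₂ e) → Joins e u v → Adj T u v
      joined ab (inj₁ (refl , refl)) = ab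
      joined {a , b} ab (inj₂ (refl , refl)) = sym-adj T a b ab
    sub-walk : ∀ {x y} (q : Star (Adj T) x y) → (∀ {e} → e ∈ₗ steps q → e ∈ₗ steps p) →
      Star (λ u v → onP u v ≡ true) x y
    sub-walk ε _ = ε
    sub-walk (_◅_ {i = x} {j = c} _ q) ⊆p =
      dec-true (onP? x c) (Any.map (λ { refl → inj₁ (refl , refl) }) (⊆p (here refl))) ◅ sub-walk q (⊆p ∘ there)
    from-s : ∀ {w} → w ∈ₗ verts p → Star (λ u v → onP u v ≡ true) s w
    from-s w∈p = sub-walk (prefixTo p w∈p) (steps-prefixTo p w∈p)
    spans : ∀ w₁ w₂ → W w₁ ≡ true → W w₂ ≡ true → Star (λ u v → onP u v ≡ true) w₁ w₂
    spans w₁ w₂ W₁ W₂ =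
      reverse (λ {u} {v} e → trans (onP-sym v u) e) (from-s (W⊆p w₁ W₁)) ◅◅ from-s (W⊆p w₂ W₂)

  -- Grow a k-set S by a 3-set S′ and shrink the union back to k vertices around S′.
  union-bound : ∀ j (S S′ : Fin n → Bool) → count S ≡ 4 + j → count S′ ≡ 3 →
    Σ[ W ∈ (Fin n → Bool) ] S′ ⊆ᵇ W × count W ≡ 4 + j × suc j * dist S + 6 ≤ (4 + j) * dist W
  union-bound j S S′ ∣S∣ ∣S′∣ = shrunk (shrink S′ a S′a j d W₀ S′⊆W₀ ∣W₀∖S′∣)
    where
    anchor : Σ[ a ∈ Fin n ] S′ a ≡ true
    anchor = count≥1⇒∃ S′ (subst (1 ≤_) (sym ∣S′∣) (s≤s z≤n))
    a : Fin n
    a = proj₁ anchor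
    S′a : S′ a ≡ true
    S′a = proj₂ anchor
    W₀ : Fin n → Bool
    W₀ z = S z ∨ S′ z
    S⊆W₀ : S ⊆ᵇ W₀
    S⊆W₀ z Sz rewrite Sz = refl
    S′⊆W₀ : S′ ⊆ᵇ W₀
    S′⊆W₀ z S′z rewrite S′z = Boolₚ.∨-zeroʳ (S z)
    m : ℕ
    m = count (W₀ ∖ S′)
    m≡ : m ≡ count (S ∖ S′)
    m≡ = count-cong λ z → lemma (S z) (S′ z)
      where
      lemma : ∀ s s′ → (s ∨ s′) ∧ not s′ ≡ s ∧ not s′
      lemma s true  = trans (Boolₚ.∧-zeroʳ (s ∨ true)) (sym (Boolₚ.∧-zeroʳ s))
      lemma s false = cong (_∧ true) (Boolₚ.∨-identityʳ s)
    m≤ : m ≤ 4 + j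
    m≤ = subst₂ _≤_ (sym m≡) ∣S∣ (count-mono {X = S ∖ S′} (λ z → ∖⇒∈ˡ {X = S} {S′}))
    ≤m : suc j ≤ m
    ≤m = +-cancelʳ-≤ 3 (suc j) m
           (subst₂ _≤_ (trans ∣S∣ (+-comm 3 (suc j))) (cong₂ _+_ (sym m≡) ∣S′∣) (count-≤-∖ S S′))
    d : ℕ
    d = m ∸ suc j
    ∣W₀∖S′∣ : m ≡ suc j + d
    ∣W₀∖S′∣ = sym (m+[n∸m]≡n ≤m)
    d≤3 : d ≤ 3
    d≤3 = +-cancelˡ-≤ (suc j) d 3 (subst (_≤ suc j + 3) ∣W₀∖S′∣ (≤-trans m≤ (≤-reflexive (+-comm 3 (suc j)))))
    shrunk : Σ[ W ∈ (Fin n → Bool) ] S′ ⊆ᵇ W × count (W ∖ S′) ≡ suc j ×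
                                     suc j * dist W₀ + d * dist S′ ≤ (suc j + d) * dist W →
             Σ[ W ∈ (Fin n → Bool) ] S′ ⊆ᵇ W × count W ≡ 4 + j × suc j * dist S + 6 ≤ (4 + j) * dist W
    shrunk (W , S′⊆W , ∣W∖S′∣ , ineq) =
      W , S′⊆W , trans (count-∖ W S′ S′⊆W) (trans (cong₂ _+_ ∣W∖S′∣ ∣S′∣) (+-comm (suc j) 3)) ,
      union-bound-arith (suc j) d (3 ∸ d) (dist S) (dist W₀) (dist S′) (dist W) (m+[n∸m]≡n d≤3)
        (dist-mono S⊆W₀) (count≡3⇒dist≥2 S′ ∣S′∣) (dist-mono S′⊆W) ineq

  eccentricity-exists : ∀ k (S₀ S₁ : Subset n) → S₀ ⊆ S₁ → ∣ S₁ ∣ ≡ k →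
    ¬ ¬ (Σ[ e ∈ ℕ ] IsSteinerEcc T k S₀ e)
  eccentricity-exists k S₀ S₁ S₀⊆S₁ ∣S₁∣ ¬ecc = ¬¬-Dec-≤ P (n * (n * 1)) λ P? →
    let (e , Pe , max) = bounded-max P (n * (n * 1)) P? bounded (dist (lookup S₁))
                                     (S₁ , S₀⊆S₁ , ∣S₁∣ , lookup-steiner S₁)
    in ¬ecc (e , Pe , λ S d S₀⊆S ∣S∣ S-d → max d (S , S₀⊆S , ∣S∣ , S-d))
    where
    P : ℕ → Set
    P e = Σ[ S ∈ Subset n ] S₀ ⊆ S × ∣ S ∣ ≡ k × IsSteinerDist T S e
    bounded : ∀ e → P e → e ≤ n * (n * 1)
    bounded e (S , _ , _ , S-e) = subst (_≤ n * (n * 1)) (sym (lookup-dist S e S-e)) (countEdges≤n² (cut (lookup S)))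


  diameter-radius-bound : ∀ j D R → IsSteinerDiameter T (4 + j) D → IsSteinerRadius T (4 + j) 3 R →
    suc j * D + 6 ≤ (4 + j) * R
  diameter-radius-bound j D R ((_ , ((S , _ , ∣S∣ , S-D) , _)) , _) ((S′ , ∣S′∣ , (_ , ecc≤R)) , _) =
    let (W , S′⊆W , ∣W∣ , bound) = union-bound j (lookup S) (lookup S′) (trans (sym (∣∣≡count S)) ∣S∣)
                                                                     (trans (sym (∣∣≡count S′)) ∣S′∣)
        S′⊆W′ : S′ ⊆ vtabulate W
        S′⊆W′ {x} x∈S′ = ∈-tabulate⁺ W (S′⊆W x ([]=⇒lookup x∈S′))
    in subst (λ D′ → suc j * D′ + 6 ≤ (4 + j) * R) (sym (lookup-dist S D S-D))
         (≤-trans bound (*-monoʳ-≤ (4 + j)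
           (ecc≤R (vtabulate W) (dist W) S′⊆W′ (trans (∣tabulate∣≡count W) ∣W∣) (tabulate-steiner W))))

-- Adjacency in an abstract graph need not be decidable; the goals below are decidable,
-- so we may assume that it is, along with reachability avoiding an edge.
decidable-graph : ∀ {n} (T : Graph n) →
  ¬ ¬ ((∀ u v → Dec (Adj T u v)) × (∀ u v a b → Dec (ReachAvoiding T u v a b)))
decidable-graph T k =
  ¬¬-∀-Fin (λ u → ¬¬-∀-Fin λ v → ¬¬-excluded-middle) λ adj? →
  ¬¬-∀-Fin (λ u → ¬¬-∀-Fin λ v → ¬¬-∀-Fin λ a → ¬¬-∀-Fin λ b → ¬¬-excluded-middle) λ reach? →
  k (adj? , reach?)

steiner-diameter-radius : ∀ {n} (T : Graph n) → IsTree T → ∀ k → 4 ≤ k → ∀ D R →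
  IsSteinerDiameter T k D → IsSteinerRadius T k 3 R → (k ∸ 3) * D + 6 ≤ k * R
steiner-diameter-radius T (conn , acyc) (suc (suc (suc (suc j)))) (s≤s (s≤s (s≤s (s≤s _)))) D R diam rad =
  decidable-stable (_ ≤? _) λ ¬bound → decidable-graph T λ (adj? , reach?) →
    ¬bound (Tree.diameter-radius-bound T conn acyc adj? reach? j D R diam rad)

-- Coordinates on a tree isomorphic to P₃(a,b;x)

-- Vertex t < M of P₃(a,b;x) is the hub vertex t when t ≤ 2, and otherwise vertex i of leg q,
-- where t = leg q i = 3 + q * x + i; legs q < a hang at hub vertex 0, the others at 2.
module Spider {n : ℕ} (T : Graph n) (a b x′ : ℕ) (iso : T ≅ P3 a b (suc x′)) where

  x N M : ℕ
  x = suc x′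
  N = a + b
  M = 3 + N * x

  private
    f : Fin n → Fin M
    f = Bijection.to (proj₁ iso)
    g : Fin M → Fin n
    g t = proj₁ (Bijection.surjective (proj₁ iso) t)
    f∘g : ∀ t → f (g t) ≡ t
    f∘g t = proj₂ (Bijection.surjective (proj₁ iso) t) refl
    g∘f : ∀ u → g (f u) ≡ u
    g∘f u = Bijection.injective (proj₁ iso) (f∘g (f u))
    clamp : ℕ → Fin M
    clamp t with t <? M
    ... | yes t<M = fromℕ< t<M
    ... | no _    = zero
    toℕ-clamp : ∀ {t} → t < M → toℕ (clamp t) ≡ t
    toℕ-clamp {t} t<M with t <? M
    ... | yes _  = Finₚ.toℕ-fromℕ< _
    ... | no t≮M = contradiction t<M t≮M
    clamp-toℕ : ∀ (t : Fin M) → clamp (toℕ t) ≡ t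
    clamp-toℕ t with toℕ t <? M
    ... | yes t<M = Finₚ.fromℕ<-toℕ t t<M
    ... | no t≮M  = contradiction (Finₚ.toℕ<n t) t≮M

  -- The vertex labelled t; a junk value when t ≥ M.
  vtx : ℕ → Fin n
  vtx t = g (clamp t)

  label : Fin n → ℕ
  label u = toℕ (f u)

  label-vtx : ∀ {t} → t < M → label (vtx t) ≡ t
  label-vtx t<M = trans (cong toℕ (f∘g _)) (toℕ-clamp t<M)

  vtx-label : ∀ u → vtx (label u) ≡ u
  vtx-label u = trans (cong g (clamp-toℕ (f u))) (g∘f u)

  vtx-injective : ∀ {t t′} → t < M → t′ < M → vtx t ≡ vtx t′ → t ≡ t′
  vtx-injective t<M t′<M eq = trans (sym (label-vtx t<M)) (trans (cong label eq) (label-vtx t′<M))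

  label<M : ∀ u → label u < M
  label<M u = Finₚ.toℕ<n (f u)

  PAdj : ℕ → ℕ → Set
  PAdj t t′ = (PEdge a b x t t′ ⊎ PEdge a b x t′ t) × t < M × t′ < M

  PAdj-sym : ∀ {t t′} → PAdj t t′ → PAdj t′ t
  PAdj-sym (inj₁ e , t<M , t′<M) = inj₂ e , t′<M , t<M
  PAdj-sym (inj₂ e , t<M , t′<M) = inj₁ e , t′<M , t<M

  lift-adj : ∀ {t t′} → PAdj t t′ → Adj T (vtx t) (vtx t′)
  lift-adj {t} {t′} (e , t<M , t′<M) = proj₂ (proj₂ iso (vtx t) (vtx t′))
    (subst₂ (λ s s′ → PEdge a b x s s′ ⊎ PEdge a b x s′ s) (sym (label-vtx t<M)) (sym (label-vtx t′<M)) e)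

  lift : ∀ {t t′} → Star PAdj t t′ → Star (Adj T) (vtx t) (vtx t′)
  lift ε       = ε
  lift (r ◅ p) = lift-adj r ◅ lift p

  inner-lift : ∀ {t t′} (p : Star PAdj t t′) → inner (lift p) ≡ map vtx (inner p)
  inner-lift ε       = refl
  inner-lift (_ ◅ p) = cong (_ ∷_) (inner-lift p)

  len-lift : ∀ {t t′} (p : Star PAdj t t′) → len (lift p) ≡ len p
  len-lift ε       = refl
  len-lift (_ ◅ p) = cong suc (len-lift p)

  ∈-lift : ∀ {t t′} (p : Star PAdj t t′) {s} → s ∈ₗ verts p → vtx s ∈ₗ verts (lift p)
  ∈-lift {t} p s∈p = subst (λ l → _ ∈ₗ (vtx t ∷ l)) (sym (inner-lift p)) (∈-map⁺ vtx s∈p)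

  ∉-lift : ∀ {t t′} (p : Star PAdj t t′) {s} → s < M → All (λ u → u < M × u ≢ s) (verts p) →
    ¬ vtx s ∈ₗ verts (lift p)
  ∉-lift {t} p {s} s<M avoid s∈p with ∈-map⁻ vtx (subst (λ l → _ ∈ₗ (vtx t ∷ l)) (inner-lift p) s∈p)
  ... | u , u∈p , s≡u with All.lookup avoid u∈p
  ...   | u<M , u≢s = u≢s (sym (vtx-injective s<M u<M s≡u))

  leg : ℕ → ℕ → ℕ
  leg q i = 3 + q * x + i

  leaf : ℕ → ℕ
  leaf q = leg q x′

  leg-end≤ : ∀ q {q′} → q < q′ → 3 + q * x + x ≤ 3 + q′ * x
  leg-end≤ q {q′} q<q′ = begin
    3 + q * x + x   ≡⟨ +-assoc 3 (q * x) x ⟩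
    3 + (q * x + x) ≡⟨ cong (3 +_) (+-comm (q * x) x) ⟩
    3 + suc q * x   ≤⟨ +-monoʳ-≤ 3 (*-monoˡ-≤ x q<q′) ⟩
    3 + q′ * x      ∎
    where open ≤-Reasoning

  leg<M : ∀ {q i} → q < N → i < x → leg q i < M
  leg<M {q} q<N i<x = <-≤-trans (+-monoʳ-< (3 + q * x) i<x) (leg-end≤ q q<N)

  leg<leg : ∀ {q q′ i j} → q < q′ → i < x → leg q i < leg q′ j
  leg<leg {q} {q′} {i} {j} q<q′ i<x =
    <-≤-trans (+-monoʳ-< (3 + q * x) i<x) (≤-trans (leg-end≤ q q<q′) (m≤m+n _ j))

  leg-mono : ∀ {q i j} → i < j → leg q i < leg q j
  leg-mono {q} = +-monoʳ-< (3 + q * x)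

  3≤leg : ∀ {q i} → 3 ≤ leg q i
  3≤leg {q} {i} = ≤-trans (m≤m+n 3 (q * x)) (m≤m+n _ i)

  leg-coordinates : ∀ t → 3 ≤ t → t < M → Σ[ q ∈ ℕ ] Σ[ i ∈ ℕ ] q < N × i < x × t ≡ leg q i
  leg-coordinates (suc (suc (suc s))) (s≤s (s≤s (s≤s _))) (s≤s (s≤s (s≤s s<Nx))) =
    s / x , s % x , *-cancelʳ-< x (s / x) N (≤-<-trans (m/n*n≤m s x) s<Nx) , m%n<n s x ,
    cong (3 +_) (trans (m≡m%n+[m/n]*n s x) (+-comm (s % x) (s / x * x)))

  0<M : 0 < M
  0<M = ≤-trans (s≤s z≤n) (m≤m+n 3 (N * x))
  1<M : 1 < M
  1<M = ≤-trans (s≤s (s≤s z≤n)) (m≤m+n 3 (N * x))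
  2<M : 2 < M
  2<M = m≤m+n 3 (N * x)

  hub01 : PAdj 0 1
  hub01 = inj₁ e01 , 0<M , 1<M

  hub12 : PAdj 1 2
  hub12 = inj₁ e12 , 1<M , 2<M

  -- Abstract for the same reason as _≟ᶠ_.
  abstract
    _<?ₙ_ : ∀ m k → Dec (m < k)
    _<?ₙ_ = _<?_

  onLeft : ℕ → Bool
  onLeft q = does (q <?ₙ a)

  foot : Bool → ℕ
  foot true  = 0
  foot false = 2

  foot≤2 : ∀ s → foot s ≤ 2
  foot≤2 true  = z≤n
  foot≤2 false = ≤-refl

  left-leg : ∀ {q} → q < a → PAdj 0 (leg q 0)
  left-leg {q} q<a =
    inj₁ (subst (PEdge a b x 0) (sym (+-identityʳ _)) (left q<a)) , 0<M , leg<M (≤-trans q<a (m≤m+n a b)) (s≤s z≤n)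

  right-leg : ∀ {q} → a ≤ q → q < N → PAdj 2 (leg q 0)
  right-leg {q} a≤q q<N = inj₁ (subst (PEdge a b x 2) (sym (+-identityʳ _)) (right a≤q q<N)) , 2<M , leg<M q<N (s≤s z≤n)

  leg-foot : ∀ q → q < N → PAdj (foot (onLeft q)) (leg q 0)
  leg-foot q q<N with q <?ₙ a
  ... | yes q<a = left-leg q<a
  ... | no  q≮a = right-leg (≮⇒≥ q≮a) q<N

  leg-step : ∀ {q i} → q < N → suc i < x → PAdj (leg q i) (leg q (suc i))
  leg-step {q} {i} q<N i+1<x =
    inj₁ (subst (PEdge a b x (leg q i)) (sym (+-suc (3 + q * x) i)) (along q<N i+1<x)) ,
    leg<M q<N (<-trans (n<1+n i) i+1<x) , leg<M q<N i+1<x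

  Between : ℕ → ℕ → ℕ → Set
  Between lo hi t = lo ≤ t × t ≤ hi

  leg-climb : ∀ q i d → q < N → d + i < x →
    Σ[ p ∈ Star PAdj (leg q i) (leg q (d + i)) ] All (Between (leg q i) (leg q (d + i))) (verts p) × len p ≡ d
  leg-climb q i zero q<N _ = ε , (≤-refl , ≤-refl) ∷ [] , refl
  leg-climb q i (suc d) q<N d+i<x with leg-climb q i d q<N (<-trans (n<1+n _) d+i<x)
  ... | p , p-between , len-p =
    p ◅◅ (leg-step q<N d+i<x ◅ ε) ,
    All-verts-◅◅ p _ (All.map (λ (lo , hi) → lo , ≤-trans hi (<⇒≤ (leg-mono {q} (n<1+n _)))) p-between)
      ((i≤ , <⇒≤ (leg-mono {q} (n<1+n _))) ∷ (≤-trans i≤ (<⇒≤ (leg-mono {q} (n<1+n _))) , ≤-refl) ∷ []) ,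
    trans (len-◅◅ p _) (trans (cong (_+ 1) len-p) (+-comm d 1))
    where
    i≤ : leg q i ≤ leg q (d + i)
    i≤ = +-monoʳ-≤ (3 + q * x) (m≤n+m i d)

  LegWalk : ℕ → ℕ → ℕ → Set
  LegWalk q i j = Σ[ p ∈ Star PAdj (leg q i) (leg q j) ] All (Between (leg q i) (leg q j)) (verts p) × len p + i ≡ j

  leg-walk : ∀ q i j → q < N → i ≤ j → j < x → LegWalk q i j
  leg-walk q i j q<N i≤j j<x with leg-climb q i (j ∸ i) q<N (subst (_< x) (sym (m∸n+n≡m i≤j)) j<x)
  ... | p , between , len-p rewrite m∸n+n≡m i≤j = p , between , trans (cong (_+ i) len-p) (m∸n+n≡m i≤j)

  hub-walk : ∀ s t → Σ[ p ∈ Star PAdj (foot s) (foot t) ] All (_≤ 2) (verts p)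
  hub-walk true  true  = ε , z≤n ∷ []
  hub-walk true  false = (hub01 ◅ hub12 ◅ ε) , z≤n ∷ s≤s z≤n ∷ ≤-refl ∷ []
  hub-walk false true  = (PAdj-sym hub12 ◅ PAdj-sym hub01 ◅ ε) , ≤-refl ∷ s≤s z≤n ∷ z≤n ∷ []
  hub-walk false false = ε , ≤-refl ∷ []

  OnHubOrLeg : ℕ → ℕ → Set
  OnHubOrLeg q t = t ≤ 2 ⊎ Between (leg q 0) (leaf q) t

  walk-to-leaf : ∀ s q → q < N → Σ[ p ∈ Star PAdj (foot s) (leaf q) ] All (OnHubOrLeg q) (verts p)
  walk-to-leaf s q q<N =
    (on-hub ◅◅ (leg-foot q q<N ◅ up)) ,
    All-verts-◅◅ on-hub (leg-foot q q<N ◅ up) (All.map inj₁ (proj₂ (hub-walk s (onLeft q))))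
      (inj₁ (foot≤2 (onLeft q)) ∷ All.map inj₂ (proj₁ (proj₂ (leg-walk q 0 x′ q<N z≤n ≤-refl))))
    where
    on-hub : Star PAdj (foot s) (foot (onLeft q))
    on-hub = proj₁ (hub-walk s (onLeft q))
    up : Star PAdj (leg q 0) (leaf q)
    up = proj₁ (leg-walk q 0 x′ q<N z≤n ≤-refl)

  walk-to-foot : ∀ q j → q < N → j < x →
    Σ[ p ∈ Star PAdj (leg q j) (foot (onLeft q)) ] All (λ t → t ≤ 2 ⊎ Between (leg q 0) (leg q j) t) (verts p)
  walk-to-foot q j q<N j<x = reverse PAdj-sym up , All-verts-reverse PAdj-sym up on-up
    where
    climb : LegWalk q 0 j
    climb = leg-walk q 0 j q<N z≤n j<x
    up : Star PAdj (foot (onLeft q)) (leg q j)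
    up = leg-foot q q<N ◅ proj₁ climb
    on-up : All (λ t → t ≤ 2 ⊎ Between (leg q 0) (leg q j) t) (verts up)
    on-up = inj₁ (foot≤2 (onLeft q)) ∷ All.map inj₂ (proj₁ (proj₂ climb))

  hub-across : ∀ s → len (proj₁ (hub-walk (not s) s)) ≡ 2 × (∀ t → t ≤ 2 → t ∈ₗ verts (proj₁ (hub-walk (not s) s)))
  hub-across true  = refl , λ { zero _ → there (there (here refl)) ; (suc zero) _ → there (here refl)
                              ; (suc (suc zero)) _ → here refl ; (suc (suc (suc _))) (s≤s (s≤s ())) }
  hub-across false = refl , λ { zero _ → here refl ; (suc zero) _ → there (here refl)
                              ; (suc (suc zero)) _ → there (there (here refl)) ; (suc (suc (suc _))) (s≤s (s≤s ())) }

  across-to-leg : ∀ q i → q < N → i < x →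
    Σ[ p ∈ Star PAdj (foot (not (onLeft q))) (leg q i) ] (∀ t → t ≤ 2 → t ∈ₗ verts p) × len p ≡ 3 + i
  across-to-leg q i q<N i<x =
    (across-hub ◅◅ (leg-foot q q<N ◅ proj₁ climb)) ,
    (λ t t≤2 → ∈-verts-◅◅ˡ across-hub _ (proj₂ (hub-across (onLeft q)) t t≤2)) ,
    trans (len-◅◅ across-hub _) (cong₂ (λ l m → l + suc m) (proj₁ (hub-across (onLeft q)))
                                                  (trans (sym (+-identityʳ _)) (proj₂ (proj₂ climb))))
    where
    across-hub : Star PAdj (foot (not (onLeft q))) (foot (onLeft q))
    across-hub = proj₁ (hub-walk (not (onLeft q)) (onLeft q))
    climb : LegWalk q 0 i
    climb = leg-walk q 0 i q<N z≤n i<x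

-- Steiner distances in P₃(a,b;x)

module SpiderBounds {n : ℕ} (T : Graph n) (conn : Connected T) (acyc : Acyclic T)
  (adj? : ∀ u v → Dec (Adj T u v)) (reach? : ∀ u v a b → Dec (ReachAvoiding T u v a b))
  (a b x′ : ℕ) (1≤a : 1 ≤ a) (1≤b : 1 ≤ b) (iso : T ≅ P3 a b (suc x′)) where

  open Tree T conn acyc adj? reach?
  open Spider T a b x′ iso
  open EdgeCounting {n}

  hub : Fin n → Bool
  hub = image vtx (0 ∷ 1 ∷ 2 ∷ [])

  hub⇒ : ∀ {w} → hub w ≡ true → Σ[ t ∈ ℕ ] t ≤ 2 × w ≡ vtx t
  hub⇒ hub-w with image⇒ vtx (0 ∷ 1 ∷ 2 ∷ []) hub-w
  ... | _ , here refl , w≡ = 0 , z≤n , w≡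
  ... | _ , there (here refl) , w≡ = 1 , s≤s z≤n , w≡
  ... | _ , there (there (here refl)) , w≡ = 2 , ≤-refl , w≡

  hub-distinct : AllPairs (λ t t′ → vtx t ≢ vtx t′) (0 ∷ 1 ∷ 2 ∷ [])
  hub-distinct = ((0≢1+n ∘ vtx-injective 0<M 1<M) ∷ (0≢1+n ∘ vtx-injective 0<M 2<M) ∷ []) ∷
                 ((0≢1+n ∘ suc-injective ∘ vtx-injective 1<M 2<M) ∷ []) ∷ [] ∷ []

  count-hub : count hub ≡ 3
  count-hub = count-image vtx (0 ∷ 1 ∷ 2 ∷ []) hub-distinct

  hub∋0 : hub (vtx 0) ≡ true
  hub∋0 = ∈-image vtx {0} {0 ∷ 1 ∷ 2 ∷ []} (here refl)

  hub-path : Star PAdj 0 2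
  hub-path = hub01 ◅ hub12 ◅ ε

  hub-path-covers : ∀ t → t ≤ 2 → t ∈ₗ verts hub-path
  hub-path-covers zero             _ = here refl
  hub-path-covers (suc zero)       _ = there (here refl)
  hub-path-covers (suc (suc zero)) _ = there (there (here refl))
  hub-path-covers (suc (suc (suc _))) (s≤s (s≤s ()))

  dist-hub+y≤ : ∀ {s t} (p : Star PAdj s t) y → (∀ t → t ≤ 2 → t ∈ₗ verts p) → label y ∈ₗ verts p →
    dist (insert y hub) ≤ len p
  dist-hub+y≤ p y hub⊆p y∈p = ≤-trans (dist≤len (lift p) (insert y hub) on-p) (≤-reflexive (len-lift p))
    where
    on-p : ∀ w → insert y hub w ≡ true → w ∈ₗ verts (lift p)
    on-p w e with insert⇒ {X = hub} e
    ... | inj₁ refl = subst (_∈ₗ verts (lift p)) (vtx-label y) (∈-lift p y∈p)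
    ... | inj₂ hub-w with hub⇒ hub-w
    ...   | t , t≤2 , refl = ∈-lift p (hub⊆p t t≤2)

  dist-hub+y≤2+x : ∀ y → dist (insert y hub) ≤ 2 + x
  dist-hub+y≤2+x y with label y <? 3
  ... | yes y<3 =
    ≤-trans (dist-hub+y≤ hub-path y hub-path-covers (hub-path-covers (label y) (≤-pred y<3))) (m≤m+n 2 x)
  ... | no y≮3 with leg-coordinates (label y) (≮⇒≥ y≮3) (label<M y)
  ...   | q , i , q<N , i<x , y≡ with across-to-leg q i q<N i<x
  ...     | p , covers , len-p = ≤-trans (dist-hub+y≤ p y covers (subst (_∈ₗ verts p) (sym y≡) (last∈verts p)))
                                         (≤-trans (≤-reflexive len-p) (+-monoʳ-≤ 2 i<x))

  dist-hub≡2 : dist hub ≡ 2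
  dist-hub≡2 = ≤-antisym
    (≤-trans (dist-mono (λ w → ∈-insert-old {X = hub} {y = vtx 0}))
             (dist-hub+y≤ hub-path (vtx 0) hub-path-covers (subst (_∈ₗ verts hub-path) (sym (label-vtx 0<M)) (here refl))))
    (count≡3⇒dist≥2 hub count-hub)

  radius≤ : ∀ r R → 3 + r ≤ n → IsSteinerRadius T (3 + r) 3 R → ¬ ¬ (R ≤ 2 + r * x)
  radius≤ r R 3+r≤n ((_ , _ , _) , min) ¬R≤ =
    eccentricity-exists (3 + r) (vtabulate hub) (vtabulate Z) (λ w∈ → ∈-tabulate⁺ Z (hub⊆Z _ (∈-tabulate⁻ hub w∈)))
                        (trans (∣tabulate∣≡count Z) ∣Z∣)
      λ (e , ecc@((S , hub⊆S , ∣S∣ , S-e) , _)) → ¬R≤ (begin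
        R                              ≤⟨ min (vtabulate hub) e (trans (∣tabulate∣≡count hub) count-hub) ecc ⟩
        e                              ≡⟨ lookup-dist S e S-e ⟩
        dist (lookup S)                ≤⟨ dist-≤-+* hub (vtx 0) hub∋0 x grow r (lookup S) (hub⊆ S hub⊆S)
                                                     (∣S∖hub∣ S ∣S∣ (hub⊆ S hub⊆S)) ⟩
        dist hub + r * x               ≡⟨ cong (_+ r * x) dist-hub≡2 ⟩
        2 + r * x                      ∎)
    where
    open ≤-Reasoning
    extended : Σ[ Z ∈ (Fin n → Bool) ] hub ⊆ᵇ Z × count Z ≡ 3 + r
    extended = ⊆-extend hub r (3 + r) (cong (_+ r) count-hub) 3+r≤n
    Z : Fin n → Bool
    Z = proj₁ extended
    hub⊆Z : hub ⊆ᵇ Z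
    hub⊆Z = proj₁ (proj₂ extended)
    ∣Z∣ : count Z ≡ 3 + r
    ∣Z∣ = proj₂ (proj₂ extended)
    hub⊆ : ∀ S → vtabulate hub ⊆ S → hub ⊆ᵇ lookup S
    hub⊆ S hub⊆S w hub-w = []=⇒lookup (hub⊆S (∈-tabulate⁺ hub hub-w))
    ∣S∖hub∣ : ∀ S → ∣ S ∣ ≡ 3 + r → hub ⊆ᵇ lookup S → count (lookup S ∖ hub) ≡ r
    ∣S∖hub∣ S ∣S∣ hub⊆S = +-cancelʳ-≡ 3 _ r (begin-equality
      count (lookup S ∖ hub) + 3           ≡⟨ cong (count (lookup S ∖ hub) +_) count-hub ⟨
      count (lookup S ∖ hub) + count hub   ≡⟨ count-∖ (lookup S) hub hub⊆S ⟨
      count (lookup S)                     ≡⟨ ∣∣≡count S ⟨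
      ∣ S ∣                                ≡⟨ trans ∣S∣ (+-comm 3 r) ⟩
      r + 3                                ∎)
    grow : ∀ y → dist (insert y hub) ≤ dist hub + x
    grow y = subst (λ d → dist (insert y hub) ≤ d + x) (sym dist-hub≡2) (dist-hub+y≤2+x y)

  -- The leaves of legs 0, …, k - 2 and N - 1: legs 0 and N - 1 hang at opposite ends of the hub.
  module Leaves (j : ℕ) (4+j≤N : 4 + j ≤ N) where

    N-1 : ℕ
    N-1 = N ∸ 1

    1+N-1≡N : suc N-1 ≡ N
    1+N-1≡N = trans (+-comm 1 (N ∸ 1)) (m∸n+n≡m (≤-trans (s≤s z≤n) 4+j≤N))

    N-1<N : N-1 < N
    N-1<N = ≤-reflexive 1+N-1≡N

    3+j≤N-1 : 3 + j ≤ N-1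
    3+j≤N-1 = ≤-pred (≤-trans 4+j≤N (≤-reflexive (sym 1+N-1≡N)))

    a≤N-1 : a ≤ N-1
    a≤N-1 = ≤-pred (subst (suc a ≤_) (sym 1+N-1≡N) (subst (_≤ N) (+-comm a 1) (+-monoʳ-≤ a 1≤b)))

    legs : List ℕ
    legs = upTo (3 + j) ++ N-1 ∷ []

    legs<N : All (_< N) legs
    legs<N = Allₚ.++⁺ (Allₚ.applyUpTo⁺₁ id (3 + j) (λ i<3+j → <-trans (≤-trans i<3+j 3+j≤N-1) N-1<N)) (N-1<N ∷ [])

    legs-sorted : AllPairs _<_ legs
    legs-sorted = AllPairsₚ.++⁺ (AllPairsₚ.applyUpTo⁺₁ id (3 + j) (λ i<i′ _ → i<i′)) ([] ∷ [])
                    (Allₚ.applyUpTo⁺₁ id (3 + j) (λ i<3+j → ≤-trans i<3+j 3+j≤N-1 ∷ []))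

    0∈legs : 0 ∈ₗ legs
    0∈legs = here refl

    N-1∈legs : N-1 ∈ₗ legs
    N-1∈legs = ∈-++⁺ʳ (upTo (3 + j)) (here refl)

    length-legs : length legs ≡ 4 + j
    length-legs = trans (length-++ (upTo (3 + j))) (trans (cong (_+ 1) (length-applyUpTo id (3 + j))) (+-comm (3 + j) 1))

    opposite : ℕ → ℕ
    opposite q with q ≟ N-1
    ... | yes _ = 0
    ... | no  _ = N-1

    opposite∈legs : ∀ q → opposite q ∈ₗ legs
    opposite∈legs q with q ≟ N-1
    ... | yes _ = 0∈legs
    ... | no  _ = N-1∈legs

    opposite≢ : ∀ q → opposite q ≢ q
    opposite≢ q with q ≟ N-1
    ... | yes refl = λ 0≡N-1 → contradiction (≤-trans (≤-trans 1≤a a≤N-1) (≤-reflexive (sym 0≡N-1))) λ ()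
    ... | no  q≢N-1 = q≢N-1 ∘ sym

    opposite<N : ∀ q → opposite q < N
    opposite<N q = All.lookup legs<N (opposite∈legs q)

    leaves : Fin n → Bool
    leaves = image (vtx ∘ leaf) legs

    leaves∋ : ∀ {q} → q ∈ₗ legs → leaves (vtx (leaf q)) ≡ true
    leaves∋ = ∈-image (vtx ∘ leaf)

    below : ℕ → ℕ → ℕ
    below q zero    = foot (onLeft q)
    below q (suc i) = leg q i

    below-adj : ∀ q i → q < N → i < x → PAdj (below q i) (leg q i)
    below-adj q zero    q<N _   = leg-foot q q<N
    below-adj q (suc i) q<N i<x = leg-step q<N i<x

    below<leg : ∀ q i → below q i < leg q i
    below<leg q zero    = ≤-trans (s≤s (foot≤2 (onLeft q))) (3≤leg {q} {0})
    below<leg q (suc i) = leg-mono {q} (n<1+n i)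

    avoids-leg : ∀ q q′ i → q < N → q′ < N → i < x → q′ ≢ q → ∀ t →
      OnHubOrLeg q′ t ⊎ t < leg q i → t < M × t ≢ leg q i
    avoids-leg q q′ i q<N q′<N i<x q′≢q t (inj₂ t<) = <-trans t< (leg<M q<N i<x) , λ t≡ → <-irrefl t≡ t<
    avoids-leg q q′ i q<N q′<N i<x q′≢q t (inj₁ (inj₁ t≤2)) =
      ≤-trans (s≤s t≤2) 2<M , λ t≡ → <-irrefl refl (≤-trans (s≤s t≤2) (subst (3 ≤_) (sym t≡) (3≤leg {q} {i})))
    avoids-leg q q′ i q<N q′<N i<x q′≢q t (inj₁ (inj₂ (lo , hi))) = ≤-<-trans hi (leg<M q′<N ≤-refl) , t≢
      where
      t≢ : t ≢ leg q i
      t≢ refl with <-cmp q′ q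
      ... | tri< q′<q _ _ = <-irrefl refl (≤-<-trans hi (leg<leg {q′} {q} {x′} {i} q′<q ≤-refl))
      ... | tri≈ _ q′≡q _ = q′≢q q′≡q
      ... | tri> _ _ q<q′ = <-irrefl refl (<-≤-trans (leg<leg {q} {q′} {i} {0} q<q′ i<x) lo)

    walk-to-opposite : ∀ q i → q < N → i < x →
      Σ[ p ∈ Star PAdj (below q i) (leaf (opposite q)) ] All (λ t → OnHubOrLeg (opposite q) t ⊎ t < leg q i) (verts p)
    walk-to-opposite q zero q<N _ = proj₁ to-leaf , All.map inj₁ (proj₂ to-leaf)
      where
      to-leaf : Σ[ p ∈ Star PAdj (foot (onLeft q)) (leaf (opposite q)) ] All (OnHubOrLeg (opposite q)) (verts p)
      to-leaf = walk-to-leaf (onLeft q) (opposite q) (opposite<N q)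
    walk-to-opposite q (suc i) q<N i<x =
      (proj₁ down ◅◅ proj₁ to-leaf) ,
      All-verts-◅◅ (proj₁ down) (proj₁ to-leaf) (All.map lower (proj₂ down)) (All.map inj₁ (proj₂ to-leaf))
      where
      to-leaf : Σ[ p ∈ Star PAdj (foot (onLeft q)) (leaf (opposite q)) ] All (OnHubOrLeg (opposite q)) (verts p)
      to-leaf = walk-to-leaf (onLeft q) (opposite q) (opposite<N q)
      down : Σ[ p ∈ Star PAdj (leg q i) (foot (onLeft q)) ] All (λ t → t ≤ 2 ⊎ Between (leg q 0) (leg q i) t) (verts p)
      down = walk-to-foot q i q<N (<-trans (n<1+n i) i<x)
      lower : ∀ {t} → t ≤ 2 ⊎ Between (leg q 0) (leg q i) t → OnHubOrLeg (opposite q) t ⊎ t < leg q (suc i)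
      lower (inj₁ t≤2)      = inj₁ (inj₁ t≤2)
      lower (inj₂ (_ , hi)) = inj₂ (≤-<-trans hi (leg-mono {q} (n<1+n i)))

    leg-edge-cut : ∀ q i → q ∈ₗ legs → i < x → cut leaves (vtx (below q i)) (vtx (leg q i)) ≡ true
    leg-edge-cut q i q∈ i<x = ⇒cut {leaves} (lift-adj (below-adj q i q<N i<x))
      ((vtx (leaf q) , leaves∋ q∈ , up-avoiding) , (vtx (leaf (opposite q)) , leaves∋ (opposite∈legs q) , across-avoiding))
      where
      q<N : q < N
      q<N = All.lookup legs<N q∈
      up : LegWalk q i x′
      up = leg-walk q i x′ q<N (≤-pred i<x) ≤-refl
      up-avoiding : Reach∖ (vtx (below q i)) (vtx (leg q i)) (vtx (leg q i)) (vtx (leaf q))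
      up-avoiding = avoidingˡ (lift (proj₁ up)) (∉-lift (proj₁ up) (<-trans (below<leg q i) (leg<M q<N i<x))
        (All.map (λ (lo , hi) → ≤-<-trans hi (leg<M q<N ≤-refl) ,
                                λ t≡ → <-irrefl refl (<-≤-trans (below<leg q i) (subst (leg q i ≤_) t≡ lo)))
                 (proj₁ (proj₂ up))))
      across : Σ[ p ∈ Star PAdj (below q i) (leaf (opposite q)) ] All (λ t → OnHubOrLeg (opposite q) t ⊎ t < leg q i) (verts p)
      across = walk-to-opposite q i q<N i<x
      across-avoiding : Reach∖ (vtx (below q i)) (vtx (leg q i)) (vtx (below q i)) (vtx (leaf (opposite q)))
      across-avoiding = avoidingʳ (lift (proj₁ across)) (∉-lift (proj₁ across) (leg<M q<N i<x)
        (All.map (avoids-leg q (opposite q) i q<N (opposite<N q) i<x (opposite≢ q) _) (proj₂ across)))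

    up-leg : ∀ q → q < N → LegWalk q 0 x′
    up-leg q q<N = leg-walk q 0 x′ q<N z≤n ≤-refl

    leg-avoids-hub : ∀ q → q < N → ∀ c → c ≤ 2 → ∀ {t} → Between (leg q 0) (leaf q) t → t < M × t ≢ c
    leg-avoids-hub q q<N c c≤2 (lo , hi) =
      ≤-<-trans hi (leg<M q<N ≤-refl) ,
      λ t≡c → <-irrefl refl (≤-trans (s≤s c≤2) (subst (3 ≤_) t≡c (≤-trans (3≤leg {q} {0}) lo)))

    0<N : 0 < N
    0<N = ≤-trans 1≤a (m≤m+n a b)

    hub01-cut : cut leaves (vtx 0) (vtx 1) ≡ true
    hub01-cut = ⇒cut {leaves} (lift-adj hub01)
      ((vtx (leaf N-1) , leaves∋ N-1∈legs , right-side) , (vtx (leaf 0) , leaves∋ 0∈legs , left-side))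
      where
      to-right : Star PAdj 1 (leaf N-1)
      to-right = hub12 ◅ right-leg a≤N-1 N-1<N ◅ proj₁ (up-leg N-1 N-1<N)
      right-side : Reach∖ (vtx 0) (vtx 1) (vtx 1) (vtx (leaf N-1))
      right-side = avoidingˡ (lift to-right) (∉-lift to-right 0<M
        ((1<M , λ ()) ∷ (2<M , λ ()) ∷ All.map (leg-avoids-hub N-1 N-1<N 0 z≤n) (proj₁ (proj₂ (up-leg N-1 N-1<N)))))
      to-left : Star PAdj 0 (leaf 0)
      to-left = left-leg 1≤a ◅ proj₁ (up-leg 0 0<N)
      left-side : Reach∖ (vtx 0) (vtx 1) (vtx 0) (vtx (leaf 0))
      left-side = avoidingʳ (lift to-left) (∉-lift to-left 1<M
        ((0<M , λ ()) ∷ All.map (leg-avoids-hub 0 0<N 1 (s≤s z≤n)) (proj₁ (proj₂ (up-leg 0 0<N)))))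

    hub12-cut : cut leaves (vtx 1) (vtx 2) ≡ true
    hub12-cut = ⇒cut {leaves} (lift-adj hub12)
      ((vtx (leaf N-1) , leaves∋ N-1∈legs , right-side) , (vtx (leaf 0) , leaves∋ 0∈legs , left-side))
      where
      to-right : Star PAdj 2 (leaf N-1)
      to-right = right-leg a≤N-1 N-1<N ◅ proj₁ (up-leg N-1 N-1<N)
      right-side : Reach∖ (vtx 1) (vtx 2) (vtx 2) (vtx (leaf N-1))
      right-side = avoidingˡ (lift to-right) (∉-lift to-right 1<M
        ((2<M , λ ()) ∷ All.map (leg-avoids-hub N-1 N-1<N 1 (s≤s z≤n)) (proj₁ (proj₂ (up-leg N-1 N-1<N)))))
      to-left : Star PAdj 1 (leaf 0)
      to-left = PAdj-sym hub01 ◅ left-leg 1≤a ◅ proj₁ (up-leg 0 0<N)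
      left-side : Reach∖ (vtx 1) (vtx 2) (vtx 1) (vtx (leaf 0))
      left-side = avoidingʳ (lift to-left) (∉-lift to-left 2<M
        ((1<M , λ ()) ∷ (0<M , λ ()) ∷ All.map (leg-avoids-hub 0 0<N 2 ≤-refl) (proj₁ (proj₂ (up-leg 0 0<N)))))

    leg-edge : ℕ → ℕ → Edge n
    leg-edge q i = vtx (below q i) , vtx (leg q i)

    leg-edges : ℕ → List (Edge n)
    leg-edges q = applyUpTo (leg-edge q) x

    cut-edges : List (Edge n)
    cut-edges = (vtx 0 , vtx 1) ∷ (vtx 1 , vtx 2) ∷ concatMap leg-edges legs

    length-cut-edges : length cut-edges ≡ 2 + (4 + j) * x
    length-cut-edges = cong (2 +_) (trans (length-legs-edges legs) (cong (_* x) length-legs))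
      where
      length-legs-edges : ∀ qs → length (concatMap leg-edges qs) ≡ length qs * x
      length-legs-edges []       = refl
      length-legs-edges (q ∷ qs) =
        trans (length-++ (leg-edges q)) (cong₂ _+_ (length-applyUpTo (leg-edge q) x) (length-legs-edges qs))

    All-leg-edges : ∀ {P : Edge n → Set} → (∀ q i → q ∈ₗ legs → i < x → P (leg-edge q i)) →
      All P (concatMap leg-edges legs)
    All-leg-edges P-leg =
      Allₚ.concat⁺ (Allₚ.map⁺ (All.tabulate λ {q} q∈ → Allₚ.applyUpTo⁺₁ (leg-edge q) x (P-leg q _ q∈)))

    cut-edges-cut : All (λ e → cut leaves (proj₁ e) (proj₂ e) ≡ true) cut-edges
    cut-edges-cut = hub01-cut ∷ hub12-cut ∷ All-leg-edges leg-edge-cut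

    label< : ∀ {t t′} → t < M → t′ < M → t < t′ → label (vtx t) < label (vtx t′)
    label< t<M t′<M t<t′ = subst₂ _<_ (sym (label-vtx t<M)) (sym (label-vtx t′<M)) t<t′

    cut-edges-increasing : All (λ e → label (proj₁ e) < label (proj₂ e)) cut-edges
    cut-edges-increasing = label< 0<M 1<M (s≤s z≤n) ∷ label< 1<M 2<M (s≤s (s≤s z≤n)) ∷
      All-leg-edges λ q i q∈ i<x → let q<N = All.lookup legs<N q∈ in
        label< (<-trans (below<leg q i) (leg<M q<N i<x)) (leg<M q<N i<x) (below<leg q i)

    legs-pairs : AllPairs (λ q q′ → q < q′ × q < N × q′ < N) legs
    legs-pairs = zip legs-sorted legs<N
      where
      zip : ∀ {qs} → AllPairs _<_ qs → All (_< N) qs → AllPairs (λ q q′ → q < q′ × q < N × q′ < N) qs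
      zip []                []               = []
      zip (q<qs ∷ sorted) (q<N ∷ qs<N) =
        All.zipWith (λ (q<q′ , q′<N) → q<q′ , q<N , q′<N) (q<qs , qs<N) ∷ zip sorted qs<N

    Higher : Edge n → Edge n → Set
    Higher e e′ = label (proj₂ e) < label (proj₂ e′)

    leg-edges-≥3 : All (λ e → 3 ≤ label (proj₂ e)) (concatMap leg-edges legs)
    leg-edges-≥3 = All-leg-edges λ q i q∈ i<x →
      subst (3 ≤_) (sym (label-vtx (leg<M (All.lookup legs<N q∈) i<x))) (3≤leg {q} {i})

    cut-edges-sorted : AllPairs Higher cut-edges
    cut-edges-sorted =
      (label< 1<M 2<M (s≤s (s≤s z≤n)) ∷
       All.map (<-≤-trans (subst (_< 3) (sym (label-vtx 1<M)) (s≤s (s≤s z≤n)))) leg-edges-≥3) ∷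
      All.map (<-≤-trans (subst (_< 3) (sym (label-vtx 2<M)) ≤-refl)) leg-edges-≥3 ∷
      AllPairsₚ.concat⁺
        (Allₚ.map⁺ (All.tabulate λ {q} q∈ → AllPairsₚ.applyUpTo⁺₁ (leg-edge q) x λ {i} {i′} i<i′ i′<x →
           let q<N = All.lookup legs<N q∈ in label< (leg<M q<N (<-trans i<i′ i′<x)) (leg<M q<N i′<x) (leg-mono {q} i<i′)))
        (AllPairsₚ.map⁺ (AllPairs.map (λ {q} {q′} (q<q′ , q<N , q′<N) →
           Allₚ.applyUpTo⁺₁ (leg-edge q) x λ {i} i<x → Allₚ.applyUpTo⁺₁ (leg-edge q′) x λ {i′} i′<x →
             label< (leg<M q<N i<x) (leg<M q′<N i′<x) (leg<leg {q} {q′} {i} {i′} q<q′ i<x)) legs-pairs))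

    dist-leaves : 2 + (4 + j) * x ≤ dist leaves
    dist-leaves = subst (_≤ dist leaves) length-cut-edges
      (length≤countEdges (cut leaves) (cut-sym leaves) cut-edges cut-edges-cut
        (All.map (λ lo<hi e → <-irrefl (cong label e) lo<hi) cut-edges-increasing)
        (increasing⇒distinct label cut-edges-increasing cut-edges-sorted))

    count-leaves : count leaves ≡ 4 + j
    count-leaves = trans (count-image (vtx ∘ leaf) legs
      (AllPairs.map (λ (q<q′ , q<N , q′<N) e → <-irrefl (vtx-injective (leg<M q<N ≤-refl) (leg<M q′<N ≤-refl) e)
                                                         (leg<leg {_} {_} {x′} {x′} q<q′ ≤-refl)) legs-pairs))
      length-legs

  diameter≥ : ∀ j D → 4 + j ≤ N → IsSteinerDiameter T (4 + j) D → ¬ ¬ (2 + (4 + j) * x ≤ D)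
  diameter≥ j D 4+j≤N (_ , max) ¬D≥ =
    eccentricity-exists (4 + j) ⁅ v ⁆ (vtabulate leaves) v∈ ∣leaves∣ λ (e , ecc) →
      ¬D≥ (≤-trans dist-leaves (≤-trans (proj₂ ecc (vtabulate leaves) (dist leaves) v∈ ∣leaves∣ (tabulate-steiner leaves))
                                          (max v e ecc)))
    where
    open Leaves j 4+j≤N
    v : Fin n
    v = vtx (leaf 0)
    v∈ : ⁅ v ⁆ ⊆ vtabulate leaves
    v∈ w∈ = ∈-tabulate⁺ leaves (subst (λ w → leaves w ≡ true) (sym (x∈⁅y⁆⇒x≡y v w∈)) (leaves∋ 0∈legs))
    ∣leaves∣ : ∣ vtabulate leaves ∣ ≡ 4 + j
    ∣leaves∣ = trans (∣tabulate∣≡count leaves) count-leaves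

tight-arith : ∀ j x D R → R ≤ 2 + suc j * x → 2 + (4 + j) * x ≤ D → (4 + j) * R ≤ suc j * D + 6
tight-arith j x D R R≤ D≥ = begin
  (4 + j) * R                   ≤⟨ *-monoʳ-≤ (4 + j) R≤ ⟩
  (4 + j) * (2 + suc j * x)     ≡⟨ solve 2 (λ j x → (con 4 :+ j) :* (con 2 :+ (con 1 :+ j) :* x)
                                                   := (con 1 :+ j) :* (con 2 :+ (con 4 :+ j) :* x) :+ con 6) refl j x ⟩
  suc j * (2 + (4 + j) * x) + 6 ≤⟨ +-monoˡ-≤ 6 (*-monoʳ-≤ (suc j) D≥) ⟩
  suc j * D + 6                 ∎
  where
  open ≤-Reasoning
  open +-*-Solver

P3-diameter-radius : ∀ {n} (T : Graph n) → IsTree T → ∀ k → 4 ≤ k → k ≤ n → ∀ D R →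
  IsSteinerDiameter T k D → IsSteinerRadius T k 3 R →
  ∀ a b x → 1 ≤ a → 1 ≤ b → 1 ≤ x → k ≤ a + b → T ≅ P3 a b x → k * R ≤ (k ∸ 3) * D + 6
P3-diameter-radius T (conn , acyc) (suc (suc (suc (suc j)))) (s≤s (s≤s (s≤s (s≤s _)))) k≤n D R diam rad
                   a b (suc x′) 1≤a 1≤b _ k≤a+b T≅P3 =
  decidable-stable (_ ≤? _) λ ¬bound → decidable-graph T λ (adj? , reach?) →
    let open SpiderBounds T conn acyc adj? reach? a b x′ 1≤a 1≤b T≅P3 in
    radius≤ (suc j) R k≤n rad λ R≤ → diameter≥ j D k≤a+b diam λ D≥ → ¬bound (tight-arith j (suc x′) D R R≤ D≥)

theorem4p6 : (n k : ℕ) → 4 ≤ k → k ≤ n → (T : Graph n) → IsTree T →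
    (D R : ℕ) → IsSteinerDiameter T k D → IsSteinerRadius T k 3 R →
    ((k ∸ 3) * D + 6 ≤ k * R)
    × ((a b x : ℕ) → 1 ≤ a → 1 ≤ b → 1 ≤ x →
       (a + b) * x ≡ n ∸ 3 → k ≤ a + b → T ≅ P3 a b x →
       (k ∸ 3) * D + 6 ≡ k * R)
theorem4p6 n k 4≤k k≤n T tree D R diam rad =
  lower , λ a b x 1≤a 1≤b 1≤x _ k≤a+b T≅P3 →
    ≤-antisym lower (P3-diameter-radius T tree k 4≤k k≤n D R diam rad a b x 1≤a 1≤b 1≤x k≤a+b T≅P3)
  where
  lower : (k ∸ 3) * D + 6 ≤ k * R
  lower = steiner-diameter-radius T tree k 4≤k D R diam rad
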